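{- Let $s\ge1$ be fixed, let $0\le k_1\le k_2\le\cdots\le k_s$ be integers and $N\ge k_s+1$; set $k_{s+1}:=N$. Then $$\frac{W(N,k_1,\ldots,k_s)}{N!}=\frac1N\sum_{r=1}^{s}B_r,$$ where $$B_r=k_r\sum_{i=k_r}^{k_{r+1}-1}\frac1i+\sum_{j=1}^{r-1}k_{r-j}\sum_{i_1=k_r+1}^{k_{r+1}-1}\frac1{i_1}\sum_{i_2=k_r}^{i_1-1}\frac1{i_2}\sum_{i_3=k_{r-1}}^{i_2-1}\frac1{i_3}\cdots\sum_{i_{j+1}=k_{r-j+1}}^{i_j-1}\frac1{i_{j+1}}.$$ For instance $B_1=k_1\sum_{i=k_1}^{k_2-1}\frac1i$, $B_2=k_2\sum_{i=k_2}^{k_3-1}\frac1i+k_1\sum_{i_1=k_2+1}^{k_3-1}\frac1{i_1}\sum_{i_2=k_2}^{i_1-1}\frac1{i_2}$, and $B_s=k_s\sum_{i=k_s}^{N-1}\frac1i+k_{s-1}\sum_{i_1=k_s+1}^{N-1}\frac1{i_1}\sum_{i_2=k_s}^{i_1-1}\frac1{i_2}+\cdots+k_1\sum_{i_1=k_s+1}^{N-1}\frac1{i_1}\sum_{i_2=k_s}^{i_1-1}\frac1{i_2}\cdots\sum_{i_s=k_2}^{i_{s-1}-1}\frac1{i_s}$. A summation whose upper limit is smaller than its lower limit is empty.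
   Context: For integers $0\le k_1\le\cdots\le k_s$, the $(k_1,\ldots,k_s)$-strategy applied to a permutation $\pi\in S_N$ (entries revealed from the left, only relative order observed) proceeds as follows: for the $i$-th selection ($1\le i\le s$) it waits until the $(i-1)$-th selection has been made (if $i\ge2$), rejects the first $k_i$ positions, and selects the next position that is a left-to-right maximum of $\pi$ (a position whose value exceeds all values to its left); at most $s$ selections are made. $W(N,k_1,\ldots,k_s)$ denotes the number of $\pi\in S_N$ for which the position holding the value $N$ is selected by this strategy; thus $W(N,k_1,\ldots,k_s)/N!$ is the probability that the strategy selects the best applicant when $\pi$ is uniformly random. -}

module Defs where

open import Data.Bool using (Bool; true; false; _∧_; _∨_; not)
open import Data.Nat using (ℕ; zero; suc; _+_; _∸_; _⊔_; _<ᵇ_; _≡ᵇ_)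
open import Data.Fin using (Fin; toℕ)
open import Data.Fin.Properties using () renaming (_≟_ to _≟ᶠ_)
open import Data.List using (List; []; _∷_; map; concatMap; filter; length; upTo; allFin; foldr; findᵇ)
open import Data.Bool.ListAction using (all; any)
open import Data.Maybe using (Maybe; just; nothing)
open import Data.Vec using (Vec; []; _∷_; toList)
open import Data.Integer using (+_)
import Data.Rational as ℚ
open ℚ using (ℚ; 0ℚ; 1ℚ)
open import Relation.Nullary.Decidable using (does)
import Data.List.Relation.Unary.Unique.DecPropositional as UniqueDec

-- Permutations of S_N, realised as all words π : Vec (Fin N) N whose
-- entries are pairwise distinct.  π(p) (1-indexed position p) has
-- value toℕ (π[p-1]) + 1 ∈ {1,…,N}.

allWords : (n m : ℕ) → List (Vec (Fin m) n)
allWords zero    m = [] ∷ []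
allWords (suc n) m = concatMap (λ x → map (x ∷_) (allWords n m)) (allFin m)

isPerm : ∀ {N} → Vec (Fin N) N → Bool
isPerm {N} π = does (UniqueDec.unique? (_≟ᶠ_ {N}) (toList π))

values : ∀ {N} → Vec (Fin N) N → List ℕ
values π = map (λ x → suc (toℕ x)) (toList π)

-- 1-indexed lookup in a list (default 0, never used in range)
at : List ℕ → ℕ → ℕ
at []       _             = 0
at (x ∷ xs) zero          = 0
at (x ∷ xs) (suc zero)    = x
at (x ∷ xs) (suc (suc p)) = at xs (suc p)

-- the list [a, a+1, …, u-1]  (i.e. a ≤ i < u; empty if u ≤ a)
range : ℕ → ℕ → List ℕ
range a u = map (λ i → a + i) (upTo (u ∸ a))

isLRMax : List ℕ → ℕ → Bool
isLRMax xs p = all (λ q → at xs q <ᵇ at xs p) (range 1 p)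

firstLRMaxAfter : List ℕ → ℕ → Maybe ℕ
firstLRMaxAfter xs b = findᵇ (isLRMax xs) (range (suc b) (suc (length xs)))

-- the positions selected by the (k₁,…,k_s)-strategy; `prev` is the
-- position of the previous selection (0 initially).  The i-th selection
-- is the first LR-maximum at a position > prev and > kᵢ.
selections : List ℕ → List ℕ → ℕ → List ℕ
selections xs []       prev = []
selections xs (k ∷ ks) prev with firstLRMaxAfter xs (prev ⊔ k)
... | nothing = []
... | just p  = p ∷ selections xs ks p

selectsBest : ∀ {N} → List ℕ → Vec (Fin N) N → Bool
selectsBest {N} ks π = any (λ p → at (values π) p ≡ᵇ N) (selections (values π) ks 0)

W : ∀ {s} (N : ℕ) → Vec ℕ s → ℕ
W N k = length (filter (λ π → T? (isPerm π ∧ selectsBest (toList k) π)) (allWords N N))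
  where open import Relation.Nullary.Decidable using (T?)

-- 1/n as a rational; the value at n = 0 is set to 0
invℕ : ℕ → ℚ
invℕ zero    = 0ℚ
invℕ (suc n) = + 1 ℚ./ suc n

fromℕ : ℕ → ℚ
fromℕ n = + n ℚ./ 1

sumℚ : List ℚ → ℚ
sumℚ = foldr ℚ._+_ 0ℚ

-- kAt k N r = k_r for 1 ≤ r ≤ s, and k_{s+1} = N (r = 0 unused)
kAt : ∀ {s} → Vec ℕ s → ℕ → ℕ → ℕ
kAt k       N zero          = 0
kAt []      N (suc r)       = N
kAt (x ∷ k) N (suc zero)    = x
kAt (x ∷ k) N (suc (suc r)) = kAt k N (suc r)

-- The weighted ratio k/i appearing in the innermost position of each
-- term of B_r (the factor k_{r-j} multiplies the innermost 1/i).  The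
-- innermost index always satisfies i ≥ k, so i = 0 forces k = 0; we use
-- the convention 0/0 = 1 (i.e. k·(1/k) = 1 for k = 0).
ratio : ℕ → ℕ → ℚ
ratio k zero    = 1ℚ
ratio k (suc i) = + k ℚ./ suc i

-- weighted nested sums: WG k [a₁,…,a_m] u  (m ≥ 1)
--   = k · Σ_{i₁=a₁}^{u-1} 1/i₁ Σ_{i₂=a₂}^{i₁-1} 1/i₂ ⋯ Σ_{i_m=a_m}^{i_{m-1}-1} 1/i_m
-- with the factor k absorbed into the innermost 1/i_m as ratio k i_m.
WG : ℕ → List ℕ → ℕ → ℚ
WG k []           u = 0ℚ
WG k (a ∷ [])     u = sumℚ (map (λ i → ratio k i) (range a u))
WG k (a ∷ b ∷ ls) u = sumℚ (map (λ i → invℕ i ℚ.* WG k (b ∷ ls) i) (range a u))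

B : ∀ {s} → Vec ℕ s → ℕ → ℕ → ℚ
B k N r =
  WG (kAt k N r) (kAt k N r ∷ []) (kAt k N (suc r))
  ℚ.+ sumℚ (map (λ j → WG (kAt k N (r ∸ j))
                          (suc (kAt k N r) ∷ map (λ m → kAt k N (r ∸ m)) (range 0 j))
                          (kAt k N (suc r)))
                (range 1 r))

module Submission where

-- Only the relative order of the values matters, and the state of the strategy (the number of
-- selections made, and whether the current maximum is selected) changes only at left-to-right
-- maxima. Counting permutations by this state gives c_{n+1}(Φ) = n·c_n(Φ) + c_n(Φ ∘ step_{n+1}),
-- hence the winning probability is (1/N) Σ_{n<N} q_n, with q_n the probability that a
-- left-to-right maximum at position n+1 would be selected. For k_r ≤ n < k_{r+1}, q_n is the
-- probability P_r(n) that fewer than r selections are made among the first n positions; it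
-- satisfies (n+1) P_r(n+1) = n P_r(n) + P_{r-1}(n) and P_r(k_r) = 1, and its solution is the
-- summand of B_r at i₁ = n.

open import Defs
open import Data.Nat using (ℕ; suc; _≤_; _!)
open import Data.Fin using (Fin)
import Data.Fin as Fin
open import Data.Vec using (Vec; lookup)
open import Data.List using (map)
import Data.Rational as ℚ
open import Relation.Binary.PropositionalEquality using (_≡_)
open import Data.Nat using (z≤n; s≤s)
open import Data.Nat.Properties using (≤-trans; <⇒≤)
open import Algebra.Bundles using (CommutativeSemiring)

module Sum {c ℓ} (R : CommutativeSemiring c ℓ) where

  open import Data.List using (List; []; _∷_; _++_; concatMap; foldr)
  open import Data.List.Relation.Unary.All using (All; []; _∷_; universal)
  open import Function using (_∘_)
  open import Level using (Level)
  open CommutativeSemiring R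
  open import Algebra.Properties.CommutativeSemigroup +-commutativeSemigroup using (interchange)
  open import Relation.Binary.Reasoning.Setoid setoid

  private variable
    a b : Level
    I : Set a
    J : Set b

  Σ : List I → (I → Carrier) → Carrier
  Σ xs f = foldr _+_ 0# (map f xs)

  Σ-cong-local : ∀ (xs : List I) {f g : I → Carrier} → All (λ x → f x ≈ g x) xs → Σ xs f ≈ Σ xs g
  Σ-cong-local []       []       = refl
  Σ-cong-local (x ∷ xs) (e ∷ es) = +-cong e (Σ-cong-local xs es)

  Σ-cong : ∀ (xs : List I) {f g : I → Carrier} → (∀ x → f x ≈ g x) → Σ xs f ≈ Σ xs g
  Σ-cong xs e = Σ-cong-local xs (universal e xs)

  Σ-++ : ∀ (xs ys : List I) f → Σ (xs ++ ys) f ≈ Σ xs f + Σ ys f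
  Σ-++ []       ys f = sym (+-identityˡ _)
  Σ-++ (x ∷ xs) ys f = trans (+-congˡ (Σ-++ xs ys f)) (sym (+-assoc (f x) _ _))

  Σ-0 : ∀ (xs : List I) → Σ xs (λ _ → 0#) ≈ 0#
  Σ-0 []       = refl
  Σ-0 (x ∷ xs) = trans (+-identityˡ _) (Σ-0 xs)

  Σ-+ : ∀ (xs : List I) f g → Σ xs (λ x → f x + g x) ≈ Σ xs f + Σ xs g
  Σ-+ []       f g = sym (+-identityˡ 0#)
  Σ-+ (x ∷ xs) f g = trans (+-congˡ (Σ-+ xs f g)) (interchange (f x) (g x) _ _)

  *-distribˡ-Σ : ∀ (xs : List I) c f → Σ xs (λ x → c * f x) ≈ c * Σ xs f
  *-distribˡ-Σ []       c f = sym (zeroʳ c)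
  *-distribˡ-Σ (x ∷ xs) c f = trans (+-congˡ (*-distribˡ-Σ xs c f)) (sym (distribˡ c (f x) _))

  *-distribʳ-Σ : ∀ (xs : List I) c f → Σ xs (λ x → f x * c) ≈ Σ xs f * c
  *-distribʳ-Σ []       c f = sym (zeroˡ c)
  *-distribʳ-Σ (x ∷ xs) c f = trans (+-congˡ (*-distribʳ-Σ xs c f)) (sym (distribʳ c (f x) _))

  Σ-map : ∀ (h : I → J) (xs : List I) f → Σ (map h xs) f ≈ Σ xs (f ∘ h)
  Σ-map h []       f = refl
  Σ-map h (x ∷ xs) f = +-congˡ (Σ-map h xs f)

  Σ-concatMap : ∀ (h : I → List J) (xs : List I) f →
                Σ (concatMap h xs) f ≈ Σ xs (λ x → Σ (h x) f)
  Σ-concatMap h []       f = refl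
  Σ-concatMap h (x ∷ xs) f = trans (Σ-++ (h x) _ f) (+-congˡ (Σ-concatMap h xs f))

  Σ-comm : (xs : List I) (ys : List J) (f : I → J → Carrier) →
           Σ xs (λ x → Σ ys (f x)) ≈ Σ ys (λ y → Σ xs (λ x → f x y))
  Σ-comm []       ys f = sym (Σ-0 ys)
  Σ-comm (x ∷ xs) ys f = begin
    Σ ys (f x) + Σ xs (λ x → Σ ys (f x))       ≈⟨ +-congˡ (Σ-comm xs ys f) ⟩
    Σ ys (f x) + Σ ys (λ y → Σ xs (λ x → f x y)) ≈⟨ sym (Σ-+ ys (f x) _) ⟩
    Σ ys (λ y → f x y + Σ xs (λ x → f x y))     ∎

module NatLists where

  open import Data.Bool using (true; false; _∧_)
  open import Data.Bool.Properties using (T-≡; ∧-identityʳ)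
  open import Data.List using (List; []; _∷_; _++_; _∷ʳ_; map; length; foldr; applyUpTo)
  open import Data.List.Properties using (map-upTo)
  open import Data.List.Relation.Unary.All as All using (All; []; _∷_)
  open import Data.Nat
  open import Data.Nat.Properties
  open import Data.Product using (_×_; _,_)
  open import Function using (_∘_)
  open import Function.Bundles using (Equivalence)
  open import Relation.Binary.PropositionalEquality
  open import Relation.Nullary.Decidable using (dec-true; dec-false)

  private variable
    m n : ℕ

  <ᵇ-true : m < n → (m <ᵇ n) ≡ true
  <ᵇ-true {m} {n} = dec-true (m <? n)

  <ᵇ-false : n ≤ m → (m <ᵇ n) ≡ false
  <ᵇ-false {n} {m} n≤m = dec-false (m <? n) (≤⇒≯ n≤m)

  ≡ᵇ-true : m ≡ n → (m ≡ᵇ n) ≡ true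
  ≡ᵇ-true {m} {n} = dec-true (m ≟ n)

  ≡ᵇ-false : m ≢ n → (m ≡ᵇ n) ≡ false
  ≡ᵇ-false {m} {n} = dec-false (m ≟ n)

  ≡ᵇ-true⇒≡ : ∀ m n → (m ≡ᵇ n) ≡ true → m ≡ n
  ≡ᵇ-true⇒≡ m n e = ≡ᵇ⇒≡ m n (Equivalence.from T-≡ e)

  ≡ᵇ-sym : ∀ m n → (m ≡ᵇ n) ≡ (n ≡ᵇ m)
  ≡ᵇ-sym zero    zero    = refl
  ≡ᵇ-sym zero    (suc n) = refl
  ≡ᵇ-sym (suc m) zero    = refl
  ≡ᵇ-sym (suc m) (suc n) = ≡ᵇ-sym m n

  ∧-<ᵇ : ∀ a b v → ((a <ᵇ v) ∧ (b <ᵇ v)) ≡ (a ⊔ b <ᵇ v)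
  ∧-<ᵇ zero    b       zero    = refl
  ∧-<ᵇ zero    b       (suc v) = refl
  ∧-<ᵇ (suc a) zero    zero    = refl
  ∧-<ᵇ (suc a) zero    (suc v) = ∧-identityʳ (a <ᵇ v)
  ∧-<ᵇ (suc a) (suc b) zero    = refl
  ∧-<ᵇ (suc a) (suc b) (suc v) = ∧-<ᵇ a b v

  segment : ℕ → ℕ → List ℕ
  segment a zero    = []
  segment a (suc l) = a ∷ segment (suc a) l

  segment-bounds : ∀ a l → All (λ q → a ≤ q × q < a + l) (segment a l)
  segment-bounds a zero    = []
  segment-bounds a (suc l) = (≤-refl , m<m+n a z<s)
    ∷ All.map (λ {q} (a<q , q<) → <⇒≤ a<q , subst (q <_) (sym (+-suc a l)) q<) (segment-bounds (suc a) l)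

  segment-∷ʳ : ∀ a l → segment a (suc l) ≡ segment a l ∷ʳ (a + l)
  segment-∷ʳ a zero    = cong (_∷ []) (sym (+-identityʳ a))
  segment-∷ʳ a (suc l) = cong (a ∷_) (trans (segment-∷ʳ (suc a) l) (cong (segment (suc a) l ∷ʳ_) (sym (+-suc a l))))

  segment-++ : ∀ a l m → segment a (l + m) ≡ segment a l ++ segment (a + l) m
  segment-++ a zero    m = cong (λ b → segment b m) (sym (+-identityʳ a))
  segment-++ a (suc l) m = cong (a ∷_) (trans (segment-++ (suc a) l m) (cong (λ b → segment (suc a) l ++ segment b m) (sym (+-suc a l))))

  segment-suc : ∀ a l → segment (suc a) l ≡ map suc (segment a l)
  segment-suc a zero    = refl
  segment-suc a (suc l) = cong (suc a ∷_) (segment-suc (suc a) l)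

  applyUpTo≡segment : ∀ (h : ℕ → ℕ) a l → (∀ i → h i ≡ a + i) → applyUpTo h l ≡ segment a l
  applyUpTo≡segment h a zero    h≗ = refl
  applyUpTo≡segment h a (suc l) h≗ = cong₂ _∷_ (trans (h≗ 0) (+-identityʳ a))
    (applyUpTo≡segment (h ∘ suc) (suc a) l (λ i → trans (h≗ (suc i)) (+-suc a i)))

  range≡segment : ∀ a u → range a u ≡ segment a (u ∸ a)
  range≡segment a u = trans (map-upTo (a +_) (u ∸ a)) (applyUpTo≡segment (a +_) a (u ∸ a) (λ _ → refl))

  segment-∸-∷ʳ : ∀ a n → a ≤ n → segment a (suc n ∸ a) ≡ segment a (n ∸ a) ∷ʳ n
  segment-∸-∷ʳ a n a≤n = begin
    segment a (suc n ∸ a)                ≡⟨ cong (segment a) (+-∸-assoc 1 a≤n) ⟩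
    segment a (suc (n ∸ a))              ≡⟨ segment-∷ʳ a (n ∸ a) ⟩
    segment a (n ∸ a) ∷ʳ (a + (n ∸ a))   ≡⟨ cong (segment a (n ∸ a) ∷ʳ_) (m+[n∸m]≡n a≤n) ⟩
    segment a (n ∸ a) ∷ʳ n               ∎
    where open ≡-Reasoning

  range-∷ʳ : ∀ a n → a ≤ n → range a (suc n) ≡ range a n ∷ʳ n
  range-∷ʳ a n a≤n = trans (range≡segment a (suc n)) (trans (segment-∸-∷ʳ a n a≤n) (cong (_∷ʳ n) (sym (range≡segment a n))))

  range-empty : ∀ a u → u ≤ a → range a u ≡ []
  range-empty a u u≤a = trans (range≡segment a u) (cong (segment a) (m≤n⇒m∸n≡0 u≤a))

  range-∷ : ∀ a u → a < u → range a u ≡ a ∷ range (suc a) u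
  range-∷ a u a<u = trans (range≡segment a u) (trans (cong (segment a) (+-∸-assoc 1 a<u)) (cong (a ∷_) (sym (range≡segment (suc a) u))))

  maximum : List ℕ → ℕ
  maximum = foldr _⊔_ 0

  length-∷ʳ : ∀ (xs : List ℕ) v → length (xs ∷ʳ v) ≡ suc (length xs)
  length-∷ʳ []       v = refl
  length-∷ʳ (x ∷ xs) v = cong suc (length-∷ʳ xs v)

  maximum-∷ʳ : ∀ xs v → maximum (xs ∷ʳ v) ≡ maximum xs ⊔ v
  maximum-∷ʳ []       v = ⊔-identityʳ v
  maximum-∷ʳ (x ∷ xs) v = trans (cong (x ⊔_) (maximum-∷ʳ xs v)) (sym (⊔-assoc x (maximum xs) v))

  ≤-maximum : ∀ xs → All (_≤ maximum xs) xs
  ≤-maximum []       = []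
  ≤-maximum (x ∷ xs) = m≤m⊔n x (maximum xs) ∷ All.map (λ p → ≤-trans p (m≤n⊔m x (maximum xs))) (≤-maximum xs)

  maximum-≤ : ∀ {M} xs → All (_≤ M) xs → maximum xs ≤ M
  maximum-≤ []       []       = z≤n
  maximum-≤ (x ∷ xs) (p ∷ ps) = ⊔-lub p (maximum-≤ xs ps)

  at-++ : ∀ xs ys p → 1 ≤ p → p ≤ length xs → at (xs ++ ys) p ≡ at xs p
  at-++ (x ∷ xs) ys (suc zero)    _ _         = refl
  at-++ (x ∷ xs) ys (suc (suc p)) _ (s≤s p≤) = at-++ xs ys (suc p) z<s p≤

  at-∷ʳ : ∀ xs v → at (xs ∷ʳ v) (suc (length xs)) ≡ v
  at-∷ʳ []           v = refl
  at-∷ʳ (x ∷ [])     v = refl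
  at-∷ʳ (x ∷ y ∷ xs) v = at-∷ʳ (y ∷ xs) v

  at≤maximum : ∀ xs p → 1 ≤ p → p ≤ length xs → at xs p ≤ maximum xs
  at≤maximum (x ∷ xs) (suc zero)    _ _         = m≤m⊔n x (maximum xs)
  at≤maximum (x ∷ xs) (suc (suc p)) _ (s≤s p≤) = ≤-trans (at≤maximum xs (suc p) z<s p≤) (m≤n⊔m x (maximum xs))

module Selections where

  open import Data.Bool using (Bool; true; false; _∧_; _∨_; if_then_else_)
  open import Data.Bool.ListAction using (all; any; and; or)
  open import Data.Bool.Properties using (if-float; ∧-zeroʳ; ∨-identityʳ)
  open import Data.List using (List; []; _∷_; _++_; _∷ʳ_; map; length; findᵇ)
  open import Data.List.Properties using (map-cong-local; map-∘)
  open import Data.List.Relation.Unary.All as All using (All; []; _∷_)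
  open import Data.Maybe using (just; nothing; _<∣>_)
  open import Data.Nat
  open import Data.Nat.Properties
  open import Data.Product using (_×_; _,_; proj₁; proj₂)
  open import Relation.Binary.PropositionalEquality
  open import Relation.Nullary using (yes; no)
  open NatLists

  private variable
    A : Set

  all-cong-local : ∀ {f g : A → Bool} (L : List A) → All (λ q → f q ≡ g q) L → all f L ≡ all g L
  all-cong-local L eqs = cong and (map-cong-local eqs)

  any-cong-local : ∀ {f g : A → Bool} (L : List A) → All (λ q → f q ≡ g q) L → any f L ≡ any g L
  any-cong-local L eqs = cong or (map-cong-local eqs)

  any-false : ∀ (f : A → Bool) L → All (λ q → f q ≡ false) L → any f L ≡ false
  any-false f []      []         = refl
  any-false f (x ∷ L) (fx ∷ eqs) rewrite fx = any-false f L eqs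

  any-∷ʳ : ∀ (f : A → Bool) L x → any f (L ∷ʳ x) ≡ (any f L ∨ f x)
  any-∷ʳ f []      x = ∨-identityʳ (f x)
  any-∷ʳ f (y ∷ L) x with f y
  ... | true  = refl
  ... | false = any-∷ʳ f L x

  findᵇ-cong-local : ∀ {f g : A → Bool} L → All (λ q → f q ≡ g q) L → findᵇ f L ≡ findᵇ g L
  findᵇ-cong-local             []      []         = refl
  findᵇ-cong-local {f = f} {g} (x ∷ L) (fx ∷ eqs) rewrite fx with g x
  ... | true  = refl
  ... | false = findᵇ-cong-local L eqs

  findᵇ-++ : ∀ (f : A → Bool) L₁ L₂ → findᵇ f (L₁ ++ L₂) ≡ (findᵇ f L₁ <∣> findᵇ f L₂)
  findᵇ-++ f []       L₂ = refl
  findᵇ-++ f (x ∷ L₁) L₂ with f x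
  ... | true  = refl
  ... | false = findᵇ-++ f L₁ L₂

  findᵇ-All : ∀ {P : A → Set} (f : A → Bool) L {p} → All P L → findᵇ f L ≡ just p → P p
  findᵇ-All f (x ∷ L) (px ∷ ps) found with f x
  findᵇ-All f (x ∷ L) (px ∷ ps) refl  | true  = px
  findᵇ-All f (x ∷ L) (px ∷ ps) found | false = findᵇ-All f L ps found

  all-at<ᵇ : ∀ xs v → 1 ≤ v → all (λ q → at xs q <ᵇ v) (segment 1 (length xs)) ≡ (maximum xs <ᵇ v)
  all-at<ᵇ []       (suc v) _   = refl
  all-at<ᵇ (y ∷ ys) v       1≤v = begin
      (y <ᵇ v) ∧ all (λ q → at (y ∷ ys) q <ᵇ v) (segment 2 (length ys))
    ≡⟨ cong (λ L → (y <ᵇ v) ∧ all (λ q → at (y ∷ ys) q <ᵇ v) L) (segment-suc 1 (length ys)) ⟩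
      (y <ᵇ v) ∧ all (λ q → at (y ∷ ys) q <ᵇ v) (map suc (segment 1 (length ys)))
    ≡⟨ cong (λ b → (y <ᵇ v) ∧ and b) (sym (map-∘ (segment 1 (length ys)))) ⟩
      (y <ᵇ v) ∧ all (λ q → at (y ∷ ys) (suc q) <ᵇ v) (segment 1 (length ys))
    ≡⟨ cong ((y <ᵇ v) ∧_) (all-cong-local (segment 1 (length ys))
         (All.map (λ { {suc q} _ → refl }) (segment-bounds 1 (length ys)))) ⟩
      (y <ᵇ v) ∧ all (λ q → at ys q <ᵇ v) (segment 1 (length ys))
    ≡⟨ cong ((y <ᵇ v) ∧_) (all-at<ᵇ ys v 1≤v) ⟩
      (y <ᵇ v) ∧ (maximum ys <ᵇ v)
    ≡⟨ ∧-<ᵇ y (maximum ys) v ⟩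
      (y ⊔ maximum ys <ᵇ v) ∎
    where open ≡-Reasoning

  isLRMax≡ : ∀ xs p → isLRMax xs p ≡ all (λ q → at xs q <ᵇ at xs p) (segment 1 (p ∸ 1))
  isLRMax≡ xs p = cong (all _) (range≡segment 1 p)

  isLRMax-∷ʳ-old : ∀ xs v p → p ≤ length xs → isLRMax (xs ∷ʳ v) p ≡ isLRMax xs p
  isLRMax-∷ʳ-old xs v zero    _  = refl
  isLRMax-∷ʳ-old xs v (suc p) p≤ = begin
      isLRMax (xs ∷ʳ v) (suc p)
    ≡⟨ isLRMax≡ (xs ∷ʳ v) (suc p) ⟩
      all (λ q → at (xs ∷ʳ v) q <ᵇ at (xs ∷ʳ v) (suc p)) (segment 1 p)
    ≡⟨ all-cong-local (segment 1 p) (All.map (λ (1≤q , q<) →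
         cong₂ _<ᵇ_ (at-++ xs _ _ 1≤q (≤-trans (<⇒≤ q<) p≤)) (at-++ xs _ (suc p) z<s p≤)) (segment-bounds 1 p)) ⟩
      all (λ q → at xs q <ᵇ at xs (suc p)) (segment 1 p)
    ≡⟨ isLRMax≡ xs (suc p) ⟨
      isLRMax xs (suc p) ∎
    where open ≡-Reasoning

  isLRMax-∷ʳ-new : ∀ xs v → 1 ≤ v → isLRMax (xs ∷ʳ v) (suc (length xs)) ≡ (maximum xs <ᵇ v)
  isLRMax-∷ʳ-new xs v 1≤v = begin
      isLRMax (xs ∷ʳ v) (suc n)
    ≡⟨ isLRMax≡ (xs ∷ʳ v) (suc n) ⟩
      all (λ q → at (xs ∷ʳ v) q <ᵇ at (xs ∷ʳ v) (suc n)) (segment 1 n)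
    ≡⟨ all-cong-local (segment 1 n) (All.map (λ (1≤q , q<) →
         cong₂ _<ᵇ_ (at-++ xs _ _ 1≤q (≤-pred q<)) (at-∷ʳ xs v)) (segment-bounds 1 n)) ⟩
      all (λ q → at xs q <ᵇ v) (segment 1 n)
    ≡⟨ all-at<ᵇ xs v 1≤v ⟩
      (maximum xs <ᵇ v) ∎
    where
    open ≡-Reasoning
    n = length xs

  firstLRMaxAfter≡ : ∀ xs b → firstLRMaxAfter xs b ≡ findᵇ (isLRMax xs) (segment (suc b) (length xs ∸ b))
  firstLRMaxAfter≡ xs b = cong (findᵇ (isLRMax xs)) (range≡segment (suc b) (suc (length xs)))

  firstLRMaxAfter-beyond : ∀ xs b → length xs ≤ b → firstLRMaxAfter xs b ≡ nothing
  firstLRMaxAfter-beyond xs b n≤b rewrite firstLRMaxAfter≡ xs b | m≤n⇒m∸n≡0 n≤b = refl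

  firstLRMaxAfter-bounds : ∀ xs b {p} → firstLRMaxAfter xs b ≡ just p → b < p × p ≤ length xs
  firstLRMaxAfter-bounds xs b {p} found with b ≤? length xs
  ... | yes b≤n = b<p , ≤-pred (subst (p <_) (cong suc (m+[n∸m]≡n b≤n)) p<)
    where
    b<p×p< = findᵇ-All (isLRMax xs) _ (segment-bounds (suc b) (length xs ∸ b)) (trans (sym (firstLRMaxAfter≡ xs b)) found)
    b<p = proj₁ b<p×p<
    p<  = proj₂ b<p×p<
  ... | no b≰n with () ← trans (sym found) (firstLRMaxAfter-beyond xs b (<⇒≤ (≰⇒> b≰n)))

  firstLRMaxAfter-∷ʳ : ∀ xs v b → 1 ≤ v →
    firstLRMaxAfter (xs ∷ʳ v) b ≡
      (firstLRMaxAfter xs b <∣> (if (b <ᵇ suc (length xs)) ∧ (maximum xs <ᵇ v) then just (suc (length xs)) else nothing))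
  firstLRMaxAfter-∷ʳ xs v b 1≤v with b ≤? length xs
  ... | yes b≤n = begin
      firstLRMaxAfter (xs ∷ʳ v) b
    ≡⟨ firstLRMaxAfter≡ (xs ∷ʳ v) b ⟩
      findᵇ (isLRMax (xs ∷ʳ v)) (segment (suc b) (length (xs ∷ʳ v) ∸ b))
    ≡⟨ cong (λ l → findᵇ (isLRMax (xs ∷ʳ v)) (segment (suc b) (l ∸ b))) (length-∷ʳ xs v) ⟩
      findᵇ (isLRMax (xs ∷ʳ v)) (segment (suc b) (suc n ∸ b))
    ≡⟨ cong (findᵇ (isLRMax (xs ∷ʳ v))) (segment-∸-∷ʳ (suc b) (suc n) (s≤s b≤n)) ⟩
      findᵇ (isLRMax (xs ∷ʳ v)) (segment (suc b) (n ∸ b) ∷ʳ suc n)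
    ≡⟨ findᵇ-++ (isLRMax (xs ∷ʳ v)) (segment (suc b) (n ∸ b)) (suc n ∷ []) ⟩
      (findᵇ (isLRMax (xs ∷ʳ v)) (segment (suc b) (n ∸ b)) <∣> findᵇ (isLRMax (xs ∷ʳ v)) (suc n ∷ []))
    ≡⟨ cong₂ _<∣>_ (findᵇ-cong-local (segment (suc b) (n ∸ b)) (All.map (λ {q} (_ , q<) →
           isLRMax-∷ʳ-old xs v q (≤-pred (subst (q <_) (cong suc (m+[n∸m]≡n b≤n)) q<))) (segment-bounds (suc b) (n ∸ b))))
         last ⟩
      (findᵇ (isLRMax xs) (segment (suc b) (n ∸ b)) <∣> (if (b <ᵇ suc n) ∧ (maximum xs <ᵇ v) then just (suc n) else nothing))
    ≡⟨ cong (_<∣> (if (b <ᵇ suc n) ∧ (maximum xs <ᵇ v) then just (suc n) else nothing)) (firstLRMaxAfter≡ xs b) ⟨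
      (firstLRMaxAfter xs b <∣> (if (b <ᵇ suc n) ∧ (maximum xs <ᵇ v) then just (suc n) else nothing)) ∎
    where
    open ≡-Reasoning
    n = length xs
    last : findᵇ (isLRMax (xs ∷ʳ v)) (suc n ∷ []) ≡ (if (b <ᵇ suc n) ∧ (maximum xs <ᵇ v) then just (suc n) else nothing)
    last rewrite isLRMax-∷ʳ-new xs v 1≤v | <ᵇ-true (s≤s b≤n) with maximum xs <ᵇ v
    ... | true  = refl
    ... | false = refl
  ... | no b≰n
    rewrite firstLRMaxAfter-beyond (xs ∷ʳ v) b (subst (_≤ b) (sym (length-∷ʳ xs v)) (≰⇒> b≰n))
          | firstLRMaxAfter-beyond xs b (<⇒≤ (≰⇒> b≰n))
          | <ᵇ-false (≰⇒> b≰n) = refl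

  threshold : List ℕ → ℕ → ℕ
  threshold []       j       = 0
  threshold (k ∷ ks) zero    = k
  threshold (k ∷ ks) (suc j) = threshold ks j

  selectable : List ℕ → ℕ → ℕ → Bool
  selectable ks j pos = (j <ᵇ length ks) ∧ (threshold ks j <ᵇ pos)

  selections-beyond : ∀ xs ks prev → length xs ≤ prev → selections xs ks prev ≡ []
  selections-beyond xs []       prev _   = refl
  selections-beyond xs (k ∷ ks) prev n≤ rewrite firstLRMaxAfter-beyond xs (prev ⊔ k) (≤-trans n≤ (m≤m⊔n prev k)) = refl

  selections-bounds : ∀ xs ks prev → All (λ p → 1 ≤ p × p ≤ length xs) (selections xs ks prev)
  selections-bounds xs []       prev = []
  selections-bounds xs (k ∷ ks) prev with firstLRMaxAfter xs (prev ⊔ k) in found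
  ... | nothing = []
  ... | just p  = (≤-trans (s≤s z≤n) b<p , p≤n) ∷ selections-bounds xs ks p
    where
    b<p = proj₁ (firstLRMaxAfter-bounds xs (prev ⊔ k) found)
    p≤n = proj₂ (firstLRMaxAfter-bounds xs (prev ⊔ k) found)

  selections-∷ʳ : ∀ xs v ks prev → 1 ≤ v → prev ≤ length xs →
    selections (xs ∷ʳ v) ks prev ≡
      (if (maximum xs <ᵇ v) ∧ selectable ks (length (selections xs ks prev)) (suc (length xs))
       then selections xs ks prev ∷ʳ suc (length xs)
       else selections xs ks prev)
  selections-∷ʳ xs v []       prev 1≤v prev≤n rewrite ∧-zeroʳ (maximum xs <ᵇ v) = refl
  selections-∷ʳ xs v (k ∷ ks) prev 1≤v prev≤n
    rewrite firstLRMaxAfter-∷ʳ xs v (prev ⊔ k) 1≤v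
    with firstLRMaxAfter xs (prev ⊔ k) in found
  ... | just p  = trans (cong (p ∷_) (selections-∷ʳ xs v ks p 1≤v (proj₂ (firstLRMaxAfter-bounds xs (prev ⊔ k) found))))
                        (if-float (p ∷_) ((maximum xs <ᵇ v) ∧ selectable ks (length (selections xs ks p)) (suc (length xs))))
  ... | nothing
    rewrite sym (∧-<ᵇ prev k (suc (length xs))) | <ᵇ-true (s≤s prev≤n)
    with maximum xs <ᵇ v | k <ᵇ suc (length xs)
  ... | true  | true  = cong (suc (length xs) ∷_) (selections-beyond _ ks _ (≤-reflexive (length-∷ʳ xs v)))
  ... | true  | false = refl
  ... | false | true  = refl
  ... | false | false = refl

  State : Set
  State = ℕ × Bool

  selectsMaximum : List ℕ → List ℕ → Bool
  selectsMaximum ks xs = any (λ p → at xs p ≡ᵇ maximum xs) (selections xs ks 0)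

  state : List ℕ → List ℕ → State
  state ks xs = length (selections xs ks 0) , selectsMaximum ks xs

  recordStep : List ℕ → ℕ → State → State
  recordStep ks pos (j , _) = if selectable ks j pos then (suc j , true) else (j , false)

  state-[] : ∀ ks → state ks [] ≡ (0 , false)
  state-[] ks rewrite selections-beyond [] ks 0 z≤n = refl

  at-selections-∷ʳ-new : ∀ ks xs v → maximum xs < v →
    All (λ p → (at (xs ∷ʳ v) p ≡ᵇ v) ≡ false) (selections xs ks 0)
  at-selections-∷ʳ-new ks xs v max<v = All.map
    (λ (1≤p , p≤n) → trans (cong (_≡ᵇ v) (at-++ xs _ _ 1≤p p≤n))
                           (≡ᵇ-false (<⇒≢ (≤-<-trans (at≤maximum xs _ 1≤p p≤n) max<v))))
    (selections-bounds xs ks 0)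

  state-∷ʳ : ∀ ks xs v → 1 ≤ v →
    state ks (xs ∷ʳ v) ≡ (if maximum xs <ᵇ v then recordStep ks (suc (length xs)) (state ks xs) else state ks xs)
  state-∷ʳ ks xs v 1≤v rewrite selections-∷ʳ xs v ks 0 1≤v z≤n | maximum-∷ʳ xs v with maximum xs <? v
  ... | no v≤max rewrite <ᵇ-false (≮⇒≥ v≤max) | m≥n⇒m⊔n≡m (≮⇒≥ v≤max) =
    cong (length sel ,_) (any-cong-local sel (All.map (λ (1≤p , p≤n) → cong (_≡ᵇ maximum xs) (at-++ xs _ _ 1≤p p≤n)) (selections-bounds xs ks 0)))
    where sel = selections xs ks 0
  ... | yes max<v rewrite <ᵇ-true max<v | m≤n⇒m⊔n≡n (<⇒≤ max<v) with selectable ks (length (selections xs ks 0)) (suc (length xs))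
  ...   | true  = cong₂ _,_ (length-∷ʳ sel (suc (length xs)))
                    (trans (any-∷ʳ _ sel (suc (length xs)))
                           (cong₂ _∨_ (any-false _ sel (at-selections-∷ʳ-new ks xs v max<v)) (≡ᵇ-true (at-∷ʳ xs v))))
    where sel = selections xs ks 0
  ...   | false = cong (length (selections xs ks 0) ,_) (any-false _ _ (at-selections-∷ʳ-new ks xs v max<v))

module WordCounting where

  open import Data.Bool using (Bool; true; false; _∧_; not; if_then_else_)
  open import Data.Bool.ListAction using (all; any)
  open import Algebra.Bundles using (CommutativeMonoid)
  open import Data.Bool.Properties using (∧-assoc; ∧-identityʳ; ∧-commutativeMonoid)
  open import Algebra.Properties.CommutativeSemigroup (CommutativeMonoid.commutativeSemigroup ∧-commutativeMonoid)
    using () renaming (interchange to ∧-interchange)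
  open import Data.Empty using (⊥-elim)
  open import Data.Fin using (toℕ) renaming (zero to fzero; suc to fsuc)
  open import Data.Fin.Properties using (toℕ<n) renaming (_≟_ to _≟ᶠ_)
  open import Data.List using (List; []; _∷_; _++_; _∷ʳ_; length; filter; tabulate; allFin)
  open import Data.List.Relation.Unary.All as All using (All; []; _∷_; all?)
  import Data.List.Relation.Unary.Unique.DecPropositional as UniqueDec
  open import Data.Nat
  open import Data.Nat.Properties
  open import Data.Nat.Tactic.RingSolver using (solve-∀)
  open import Data.Product using (_×_; _,_; proj₁; proj₂)
  open import Data.Sum as ⊎ using (_⊎_; inj₁; inj₂; [_,_]′)
  open import Data.Vec using (toList) renaming ([] to []ᵥ; _∷_ to _∷ᵥ_; _∷ʳ_ to _∷ʳᵥ_)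
  open import Function using (_∘_; id)
  open import Relation.Binary.PropositionalEquality
  open import Relation.Nullary using (Dec; yes; no; does; ¬?)
  open import Relation.Nullary.Decidable using (T?)
  open NatLists
  open Selections
  open Sum +-*-commutativeSemiring

  ⟦_⟧ : Bool → ℕ
  ⟦ true  ⟧ = 1
  ⟦ false ⟧ = 0

  ⟦∧⟧ : ∀ a b → ⟦ a ∧ b ⟧ ≡ ⟦ a ⟧ * ⟦ b ⟧
  ⟦∧⟧ true  b = sym (+-identityʳ ⟦ b ⟧)
  ⟦∧⟧ false b = refl

  ⟦⟧≤1 : ∀ b → ⟦ b ⟧ ≤ 1
  ⟦⟧≤1 true  = s≤s z≤n
  ⟦⟧≤1 false = z≤n

  length-filter : ∀ {A : Set} (b : A → Bool) L → length (filter (T? ∘ b) L) ≡ Σ L (⟦_⟧ ∘ b)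
  length-filter b []      = refl
  length-filter b (x ∷ L) with b x
  ... | true  = cong suc (length-filter b L)
  ... | false = length-filter b L

  Σ-mono : ∀ {A : Set} (L : List A) {f g : A → ℕ} → (∀ x → f x ≤ g x) → Σ L f ≤ Σ L g
  Σ-mono []      f≤g = z≤n
  Σ-mono (x ∷ L) f≤g = +-mono-≤ (f≤g x) (Σ-mono L f≤g)

  valuesOf : ∀ {n M} → Vec (Fin M) n → List ℕ
  valuesOf w = map (suc ∘ toℕ) (toList w)

  valuesOf-∷ʳ : ∀ {n M} (w : Vec (Fin M) n) x → valuesOf (w ∷ʳᵥ x) ≡ valuesOf w ∷ʳ suc (toℕ x)
  valuesOf-∷ʳ []ᵥ       x = refl
  valuesOf-∷ʳ (y ∷ᵥ w) x = cong (suc (toℕ y) ∷_) (valuesOf-∷ʳ w x)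

  length-valuesOf : ∀ {n M} (w : Vec (Fin M) n) → length (valuesOf w) ≡ n
  length-valuesOf []ᵥ       = refl
  length-valuesOf (y ∷ᵥ w) = cong suc (length-valuesOf w)

  valuesOf-bounds : ∀ {n M} (w : Vec (Fin M) n) → All (λ v → 1 ≤ v × v ≤ M) (valuesOf w)
  valuesOf-bounds []ᵥ       = []
  valuesOf-bounds (y ∷ᵥ w) = (s≤s z≤n , toℕ<n y) ∷ valuesOf-bounds w

  Σ-allWords-∷ʳ : ∀ n M (g : Vec (Fin M) (suc n) → ℕ) →
    Σ (allWords (suc n) M) g ≡ Σ (allWords n M) (λ w → Σ (allFin M) (λ x → g (w ∷ʳᵥ x)))
  Σ-allWords-∷ʳ zero M g = begin
    Σ (allWords 1 M) g                                 ≡⟨ Σ-concatMap _ (allFin M) g ⟩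
    Σ (allFin M) (λ x → g (x ∷ᵥ []ᵥ) + 0)              ≡⟨ Σ-cong (allFin M) (λ x → +-identityʳ (g (x ∷ᵥ []ᵥ))) ⟩
    Σ (allFin M) (λ x → g (x ∷ᵥ []ᵥ))                  ≡⟨ +-identityʳ _ ⟨
    Σ (allFin M) (λ x → g (x ∷ᵥ []ᵥ)) + 0              ∎
    where open ≡-Reasoning
  Σ-allWords-∷ʳ (suc n) M g = begin
    Σ (allWords (suc (suc n)) M) g
      ≡⟨ Σ-concatMap _ (allFin M) g ⟩
    Σ (allFin M) (λ y → Σ (map (y ∷ᵥ_) (allWords (suc n) M)) g)
      ≡⟨ Σ-cong (allFin M) (λ y → trans (Σ-map (y ∷ᵥ_) (allWords (suc n) M) g) (Σ-allWords-∷ʳ n M (g ∘ (y ∷ᵥ_)))) ⟩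
    Σ (allFin M) (λ y → Σ (allWords n M) (λ w → Σ (allFin M) (λ x → g (y ∷ᵥ (w ∷ʳᵥ x)))))
      ≡⟨ Σ-cong (allFin M) (λ y → Σ-map (y ∷ᵥ_) (allWords n M) _) ⟨
    Σ (allFin M) (λ y → Σ (map (y ∷ᵥ_) (allWords n M)) (λ w → Σ (allFin M) (λ x → g (w ∷ʳᵥ x))))
      ≡⟨ Σ-concatMap _ (allFin M) _ ⟨
    Σ (allWords (suc n) M) (λ w → Σ (allFin M) (λ x → g (w ∷ʳᵥ x))) ∎
    where open ≡-Reasoning

  Σ-tabulate : ∀ {B : Set} n (f : Fin n → B) (g : B → ℕ) (h : ℕ → ℕ) a →
    (∀ i → g (f i) ≡ h (a + toℕ i)) → Σ (tabulate f) g ≡ Σ (segment a n) h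
  Σ-tabulate zero    f g h a g∘f≗ = refl
  Σ-tabulate (suc n) f g h a g∘f≗ = cong₂ _+_ (trans (g∘f≗ fzero) (cong h (+-identityʳ a)))
    (Σ-tabulate n (f ∘ fsuc) g h (suc a) (λ i → trans (g∘f≗ (fsuc i)) (cong h (+-suc a (toℕ i)))))

  Σwords : ℕ → ℕ → (List ℕ → ℕ) → ℕ
  Σwords n M f = Σ (allWords n M) (f ∘ valuesOf)

  Σwords-suc : ∀ n M f → Σwords (suc n) M f ≡ Σwords n M (λ xs → Σ (segment 1 M) (λ v → f (xs ∷ʳ v)))
  Σwords-suc n M f = trans (Σ-allWords-∷ʳ n M (f ∘ valuesOf)) (Σ-cong (allWords n M)
    (λ w → Σ-tabulate M id (λ x → f (valuesOf (w ∷ʳᵥ x))) (λ v → f (valuesOf w ∷ʳ v)) 1 (λ i → cong f (valuesOf-∷ʳ w i))))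

  fresh : ℕ → List ℕ → Bool
  fresh v xs = all (λ y → not (v ≡ᵇ y)) xs

  distinct : List ℕ → Bool
  distinct []       = true
  distinct (x ∷ xs) = fresh x xs ∧ distinct xs

  all-∷ʳ : ∀ (f : ℕ → Bool) xs v → all f (xs ∷ʳ v) ≡ (all f xs ∧ f v)
  all-∷ʳ f []       v = ∧-identityʳ (f v)
  all-∷ʳ f (y ∷ ys) v = trans (cong (f y ∧_) (all-∷ʳ f ys v)) (sym (∧-assoc (f y) (all f ys) (f v)))

  distinct-∷ʳ : ∀ xs v → distinct (xs ∷ʳ v) ≡ (distinct xs ∧ fresh v xs)
  distinct-∷ʳ []       v = refl
  distinct-∷ʳ (x ∷ xs) v =
    trans (cong₂ _∧_ (all-∷ʳ (λ y → not (x ≡ᵇ y)) xs v) (distinct-∷ʳ xs v))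
          (trans (∧-interchange (fresh x xs) (not (x ≡ᵇ v)) (distinct xs) (fresh v xs))
                 (cong (λ b → (fresh x xs ∧ distinct xs) ∧ (not b ∧ fresh v xs)) (≡ᵇ-sym x v)))

  isPerm≡distinct : ∀ {N} (π : Vec (Fin N) N) → isPerm π ≡ distinct (valuesOf π)
  isPerm≡distinct π = unique?≡ (toList π)
    where
    ≟ᶠ≡ : ∀ {M} (x y : Fin M) → does (x ≟ᶠ y) ≡ (toℕ x ≡ᵇ toℕ y)
    ≟ᶠ≡ fzero    fzero    = refl
    ≟ᶠ≡ fzero    (fsuc y) = refl
    ≟ᶠ≡ (fsuc x) fzero    = refl
    ≟ᶠ≡ (fsuc x) (fsuc y) = ≟ᶠ≡ x y
    fresh?≡ : ∀ {M} (x : Fin M) l → does (all? (λ y → ¬? (x ≟ᶠ y)) l) ≡ fresh (suc (toℕ x)) (map (suc ∘ toℕ) l)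
    fresh?≡ x []      = refl
    fresh?≡ x (y ∷ l) = cong₂ _∧_ (cong not (≟ᶠ≡ x y)) (fresh?≡ x l)
    unique?≡ : ∀ {M} (l : List (Fin M)) → does (UniqueDec.unique? _≟ᶠ_ l) ≡ distinct (map (suc ∘ toℕ) l)
    unique?≡ []      = refl
    unique?≡ (x ∷ l) = cong₂ _∧_ (fresh?≡ x l) (unique?≡ l)

  Σ-segment-1 : ∀ a l → Σ (segment a l) (λ _ → 1) ≡ l
  Σ-segment-1 a zero    = refl
  Σ-segment-1 a (suc l) = cong suc (Σ-segment-1 (suc a) l)

  Σ-≡ᵇ-outside : ∀ a l t → t < a ⊎ a + l ≤ t → Σ (segment a l) (λ v → ⟦ v ≡ᵇ t ⟧) ≡ 0
  Σ-≡ᵇ-outside a zero    t _   = refl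
  Σ-≡ᵇ-outside a (suc l) t out = cong₂ _+_ (cong ⟦_⟧ (≡ᵇ-false a≢t)) (Σ-≡ᵇ-outside (suc a) l t out′)
    where
    a≢t : a ≢ t
    a≢t refl = [ <-irrefl refl , (λ a+l<a → <-irrefl refl (≤-trans (s≤s (m≤m+n a l)) (subst (_≤ a) (+-suc a l) a+l<a))) ]′ out
    out′ : t < suc a ⊎ suc a + l ≤ t
    out′ = ⊎.map (λ t<a → ≤-trans t<a (n≤1+n a)) (subst (_≤ t) (+-suc a l)) out

  Σ-≡ᵇ-inside : ∀ a l t → a ≤ t → t < a + l → Σ (segment a l) (λ v → ⟦ v ≡ᵇ t ⟧) ≡ 1
  Σ-≡ᵇ-inside a zero    t a≤t t< = ⊥-elim (<-irrefl refl (≤-trans t< (subst (_≤ t) (sym (+-identityʳ a)) a≤t)))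
  Σ-≡ᵇ-inside a (suc l) t a≤t t< with a ≟ t
  ... | yes refl = cong₂ _+_ (cong ⟦_⟧ (≡ᵇ-true {a} refl)) (Σ-≡ᵇ-outside (suc a) l a (inj₁ (n<1+n a)))
  ... | no a≢t   = cong₂ _+_ (cong ⟦_⟧ (≡ᵇ-false a≢t)) (Σ-≡ᵇ-inside (suc a) l t (≤∧≢⇒< a≤t a≢t) (subst (t <_) (+-suc a l) t<))

  Σ-≡ᵇ-above : ∀ a l t → t < suc a + l → Σ (segment (suc a) l) (λ v → ⟦ v ≡ᵇ t ⟧) ≡ ⟦ a <ᵇ t ⟧
  Σ-≡ᵇ-above a l t t< with a <? t
  ... | yes a<t = trans (Σ-≡ᵇ-inside (suc a) l t a<t t<) (cong ⟦_⟧ (sym (<ᵇ-true a<t)))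
  ... | no a≮t  = trans (Σ-≡ᵇ-outside (suc a) l t (inj₁ (s≤s (≮⇒≥ a≮t)))) (cong ⟦_⟧ (sym (<ᵇ-false (≮⇒≥ a≮t))))

  ⟦<ᵇ⟧≡Σ : ∀ x t → ⟦ x <ᵇ t ⟧ ≡ Σ (segment 0 t) (λ m → ⟦ x ≡ᵇ m ⟧)
  ⟦<ᵇ⟧≡Σ x t = trans (by-decision (x <? t)) (Σ-cong (segment 0 t) (λ m → cong ⟦_⟧ (≡ᵇ-sym m x)))
    where
    by-decision : Dec (x < t) → ⟦ x <ᵇ t ⟧ ≡ Σ (segment 0 t) (λ m → ⟦ m ≡ᵇ x ⟧)
    by-decision (yes x<t) = trans (cong ⟦_⟧ (<ᵇ-true x<t)) (sym (Σ-≡ᵇ-inside 0 t x z≤n x<t))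
    by-decision (no x≮t)  = trans (cong ⟦_⟧ (<ᵇ-false (≮⇒≥ x≮t))) (sym (Σ-≡ᵇ-outside 0 t x (inj₂ (≮⇒≥ x≮t))))

  count-fresh : ∀ xs m → distinct xs ≡ true → All (λ x → 1 ≤ x × x ≤ m) xs →
    Σ (segment 1 m) (λ v → ⟦ fresh v xs ⟧) + length xs ≡ m
  count-fresh []       m _  []                  = trans (+-identityʳ _) (Σ-segment-1 1 m)
  count-fresh (x ∷ xs) m dx ((1≤x , x≤m) ∷ bds) = begin
      Σ (segment 1 m) (λ v → ⟦ fresh v (x ∷ xs) ⟧) + suc (length xs)
    ≡⟨ cong (λ c → Σ (segment 1 m) (λ v → ⟦ fresh v (x ∷ xs) ⟧) + (c + length xs)) (Σ-≡ᵇ-inside 1 m x 1≤x (s≤s x≤m)) ⟨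
      Σ (segment 1 m) (λ v → ⟦ fresh v (x ∷ xs) ⟧) + (Σ (segment 1 m) (λ v → ⟦ v ≡ᵇ x ⟧) + length xs)
    ≡⟨ +-assoc (Σ (segment 1 m) (λ v → ⟦ fresh v (x ∷ xs) ⟧)) _ _ ⟨
      Σ (segment 1 m) (λ v → ⟦ fresh v (x ∷ xs) ⟧) + Σ (segment 1 m) (λ v → ⟦ v ≡ᵇ x ⟧) + length xs
    ≡⟨ cong (_+ length xs) (Σ-+ (segment 1 m) _ _) ⟨
      Σ (segment 1 m) (λ v → ⟦ fresh v (x ∷ xs) ⟧ + ⟦ v ≡ᵇ x ⟧) + length xs
    ≡⟨ cong (_+ length xs) (Σ-cong (segment 1 m) split) ⟩
      Σ (segment 1 m) (λ v → ⟦ fresh v xs ⟧) + length xs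
    ≡⟨ count-fresh xs m (proj₂ dx′) bds ⟩
      m ∎
    where
    open ≡-Reasoning
    dx′ = ∧-true⇒× dx
      where
      ∧-true⇒× : ∀ {a b} → (a ∧ b) ≡ true → a ≡ true × b ≡ true
      ∧-true⇒× {true} {true} _ = refl , refl
    -- x is fresh in xs, so v is fresh in x ∷ xs exactly when it is fresh in xs and differs from x
    split : ∀ v → ⟦ fresh v (x ∷ xs) ⟧ + ⟦ v ≡ᵇ x ⟧ ≡ ⟦ fresh v xs ⟧
    split v with v ≡ᵇ x in v≡ᵇx
    ... | true  = cong ⟦_⟧ (sym (subst (λ y → fresh y xs ≡ true) (sym (≡ᵇ-true⇒≡ v x v≡ᵇx)) (proj₁ dx′)))
    ... | false = +-identityʳ _

  fresh-above : ∀ xs m v → All (_≤ m) xs → m < v → fresh v xs ≡ true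
  fresh-above []       m v []         _   = refl
  fresh-above (x ∷ xs) m v (x≤m ∷ ps) m<v rewrite ≡ᵇ-sym v x | ≡ᵇ-false (<⇒≢ (≤-<-trans x≤m m<v)) = fresh-above xs m v ps m<v

  -- subsetsWithMax n m = C(m-1, n-1): the number of n-element subsets of {1,…,m} containing m.
  subsetsWithMax : ℕ → ℕ → ℕ
  subsetsWithMax zero    zero    = 1
  subsetsWithMax zero    (suc m) = 0
  subsetsWithMax (suc n) zero    = 0
  subsetsWithMax (suc n) (suc m) = subsetsWithMax (suc n) m + subsetsWithMax n m

  subsetsWithMax-< : ∀ n m → m < n → subsetsWithMax n m ≡ 0
  subsetsWithMax-< (suc n) zero    _         = refl
  subsetsWithMax-< (suc n) (suc m) (s≤s m<n) = cong₂ _+_ (subsetsWithMax-< (suc n) m (<-trans (n<1+n m) (s≤s m<n))) (subsetsWithMax-< n m m<n)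

  subsetsWithMax-diag : ∀ n → subsetsWithMax n n ≡ 1
  subsetsWithMax-diag zero    = refl
  subsetsWithMax-diag (suc n) = cong₂ _+_ (subsetsWithMax-< (suc n) n (n<1+n n)) (subsetsWithMax-diag n)

  Σ-subsetsWithMax : ∀ n t → Σ (segment 0 t) (subsetsWithMax n) ≡ subsetsWithMax (suc n) t
  Σ-subsetsWithMax n zero    = refl
  Σ-subsetsWithMax n (suc t) = begin
    Σ (segment 0 (suc t)) (subsetsWithMax n)                            ≡⟨ cong (λ L → Σ L (subsetsWithMax n)) (segment-∷ʳ 0 t) ⟩
    Σ (segment 0 t ∷ʳ t) (subsetsWithMax n)                             ≡⟨ Σ-++ (segment 0 t) (t ∷ []) (subsetsWithMax n) ⟩
    Σ (segment 0 t) (subsetsWithMax n) + (subsetsWithMax n t + 0)       ≡⟨ cong₂ _+_ (Σ-subsetsWithMax n t) (+-identityʳ _) ⟩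
    subsetsWithMax (suc n) t + subsetsWithMax n t                       ∎
    where open ≡-Reasoning

  subsetsWithMax-absorb : ∀ n m → (m ∸ n) * subsetsWithMax n m ≡ n * subsetsWithMax (suc n) m
  subsetsWithMax-absorb zero    zero    = refl
  subsetsWithMax-absorb zero    (suc m) = *-zeroʳ (suc m)
  subsetsWithMax-absorb (suc n) zero    = sym (*-zeroʳ (suc n))
  subsetsWithMax-absorb (suc n) (suc m) with suc n ≤? m
  ... | yes n<m = begin
      (m ∸ n) * (c₁ + c₀)            ≡⟨ *-distribˡ-+ (m ∸ n) c₁ c₀ ⟩
      (m ∸ n) * c₁ + (m ∸ n) * c₀    ≡⟨ cong ((m ∸ n) * c₁ +_) (subsetsWithMax-absorb n m) ⟩
      (m ∸ n) * c₁ + n * c₁          ≡⟨ *-distribʳ-+ c₁ (m ∸ n) n ⟨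
      (m ∸ n + n) * c₁              ≡⟨ cong (_* c₁) (trans (m∸n+n≡m (<⇒≤ n<m)) (sym (m∸n+n≡m n<m))) ⟩
      (m ∸ suc n + suc n) * c₁      ≡⟨ *-distribʳ-+ c₁ (m ∸ suc n) (suc n) ⟩
      (m ∸ suc n) * c₁ + suc n * c₁  ≡⟨ cong (_+ suc n * c₁) (subsetsWithMax-absorb (suc n) m) ⟩
      suc n * c₂ + suc n * c₁        ≡⟨ *-distribˡ-+ (suc n) c₂ c₁ ⟨
      suc n * (c₂ + c₁)              ∎
    where
    open ≡-Reasoning
    c₁ = subsetsWithMax (suc n) m
    c₀ = subsetsWithMax n m
    c₂ = subsetsWithMax (suc (suc n)) m
  ... | no n≮m = begin
      (m ∸ n) * (c₁ + c₀)  ≡⟨ cong (_* (c₁ + c₀)) (m≤n⇒m∸n≡0 m≤n) ⟩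
      0                  ≡⟨ *-zeroʳ (suc n) ⟨
      suc n * 0          ≡⟨ cong (suc n *_) (cong₂ _+_ (subsetsWithMax-< (suc (suc n)) m (<-trans m<sn (n<1+n _))) (subsetsWithMax-< (suc n) m m<sn)) ⟨
      suc n * (c₂ + c₁)    ∎
    where
    open ≡-Reasoning
    c₁ = subsetsWithMax (suc n) m
    c₀ = subsetsWithMax n m
    c₂ = subsetsWithMax (suc (suc n)) m
    m<sn = ≰⇒> n≮m
    m≤n = ≤-pred m<sn

  module _ (ks : List ℕ) where

    -- The (n+1)-th value is a new maximum in exactly one of its n+1 possible relative ranks,
    -- and only then does the state of the strategy change.
    permCount : ℕ → (State → Bool) → ℕ
    permCount zero    Φ = ⟦ Φ (0 , false) ⟧
    permCount (suc n) Φ = n * permCount n Φ + permCount n (Φ ∘ recordStep ks (suc n))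

    permCount-cong : ∀ n {Φ Ψ : State → Bool} → (∀ x → Φ x ≡ Ψ x) → permCount n Φ ≡ permCount n Ψ
    permCount-cong zero    Φ≗Ψ = cong ⟦_⟧ (Φ≗Ψ (0 , false))
    permCount-cong (suc n) Φ≗Ψ = cong₂ (λ a b → n * a + b) (permCount-cong n Φ≗Ψ) (permCount-cong n (Φ≗Ψ ∘ recordStep ks (suc n)))

    permCount-false : ∀ n → permCount n (λ _ → false) ≡ 0
    permCount-false zero    = refl
    permCount-false (suc n) rewrite permCount-false n = trans (+-identityʳ (n * 0)) (*-zeroʳ n)

    hasMax : (State → Bool) → ℕ → List ℕ → ℕ
    hasMax Φ m xs = ⟦ distinct xs ⟧ * (⟦ maximum xs ≡ᵇ m ⟧ * ⟦ Φ (state ks xs) ⟧)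

    hasMaxBelow : (State → Bool) → ℕ → List ℕ → ℕ
    hasMaxBelow Φ t xs = ⟦ distinct xs ⟧ * (⟦ maximum xs <ᵇ t ⟧ * ⟦ Φ (state ks xs) ⟧)

    countWithMax : ℕ → ℕ → (State → Bool) → ℕ → ℕ
    countWithMax n M Φ m = Σwords n M (hasMax Φ m)

    module _ (xs : List ℕ) (Φ : State → Bool) (m′ : ℕ) where

      private
        m  = maximum xs
        s  = state ks xs
        s⁺ = recordStep ks (suc (length xs)) s

      appended : ℕ → ℕ
      appended v = ⟦ fresh v xs ⟧ * (⟦ m ⊔ v ≡ᵇ m′ ⟧ * ⟦ Φ (if m <ᵇ v then s⁺ else s) ⟧)

      Σ-appended-old : distinct xs ≡ true → All (λ x → 1 ≤ x) xs →
        Σ (segment 1 m) appended ≡ (m ∸ length xs) * (⟦ m ≡ᵇ m′ ⟧ * ⟦ Φ s ⟧)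
      Σ-appended-old dxs 1≤xs = begin
          Σ (segment 1 m) appended
        ≡⟨ Σ-cong-local (segment 1 m) (All.map (λ {v} (_ , v≤m) → cong (λ c → ⟦ fresh v xs ⟧ * c)
             (cong₂ (λ a b → ⟦ a ≡ᵇ m′ ⟧ * ⟦ Φ (if b then s⁺ else s) ⟧) (m≥n⇒m⊔n≡m (≤-pred v≤m)) (<ᵇ-false (≤-pred v≤m))))
             (segment-bounds 1 m)) ⟩
          Σ (segment 1 m) (λ v → ⟦ fresh v xs ⟧ * (⟦ m ≡ᵇ m′ ⟧ * ⟦ Φ s ⟧))
        ≡⟨ *-distribʳ-Σ (segment 1 m) _ (λ v → ⟦ fresh v xs ⟧) ⟩
          Σ (segment 1 m) (λ v → ⟦ fresh v xs ⟧) * (⟦ m ≡ᵇ m′ ⟧ * ⟦ Φ s ⟧)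
        ≡⟨ cong (_* (⟦ m ≡ᵇ m′ ⟧ * ⟦ Φ s ⟧)) (trans (sym (m+n∸n≡m _ (length xs))) (cong (_∸ length xs) (count-fresh xs m dxs bounds))) ⟩
          (m ∸ length xs) * (⟦ m ≡ᵇ m′ ⟧ * ⟦ Φ s ⟧) ∎
        where
        open ≡-Reasoning
        bounds = All.zipWith (λ (1≤x , x≤m) → 1≤x , x≤m) (1≤xs , ≤-maximum xs)

      Σ-appended-new : ∀ M → m ≤ M → m′ ≤ M →
        Σ (segment (suc m) (M ∸ m)) appended ≡ ⟦ m <ᵇ m′ ⟧ * ⟦ Φ s⁺ ⟧
      Σ-appended-new M m≤M m′≤M = begin
          Σ (segment (suc m) (M ∸ m)) appended
        ≡⟨ Σ-cong-local (segment (suc m) (M ∸ m)) (All.map (λ {v} (m<v , _) →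
             trans (cong₂ (λ a c → ⟦ a ⟧ * c) (fresh-above xs m v (≤-maximum xs) m<v)
                     (cong₂ (λ a b → ⟦ a ≡ᵇ m′ ⟧ * ⟦ Φ (if b then s⁺ else s) ⟧) (m≤n⇒m⊔n≡n (<⇒≤ m<v)) (<ᵇ-true m<v)))
                   (+-identityʳ _))
             (segment-bounds (suc m) (M ∸ m))) ⟩
          Σ (segment (suc m) (M ∸ m)) (λ v → ⟦ v ≡ᵇ m′ ⟧ * ⟦ Φ s⁺ ⟧)
        ≡⟨ *-distribʳ-Σ (segment (suc m) (M ∸ m)) _ (λ v → ⟦ v ≡ᵇ m′ ⟧) ⟩
          Σ (segment (suc m) (M ∸ m)) (λ v → ⟦ v ≡ᵇ m′ ⟧) * ⟦ Φ s⁺ ⟧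
        ≡⟨ cong (_* ⟦ Φ s⁺ ⟧) (Σ-≡ᵇ-above m (M ∸ m) m′ (s≤s (subst (m′ ≤_) (sym (m+[n∸m]≡n m≤M)) m′≤M))) ⟩
          ⟦ m <ᵇ m′ ⟧ * ⟦ Φ s⁺ ⟧ ∎
        where open ≡-Reasoning

      private
        ∸-*-⟦≡ᵇ⟧ : ∀ a b n c → (a ∸ n) * (⟦ a ≡ᵇ b ⟧ * c) ≡ (b ∸ n) * (⟦ a ≡ᵇ b ⟧ * c)
        ∸-*-⟦≡ᵇ⟧ a b n c with a ≟ b
        ... | yes refl = refl
        ... | no a≢b rewrite ≡ᵇ-false a≢b = trans (*-zeroʳ (a ∸ n)) (sym (*-zeroʳ (b ∸ n)))

        Σ-appended : ∀ M → All (λ x → 1 ≤ x × x ≤ M) xs → m′ ≤ M → ∀ d → (d ≡ true → distinct xs ≡ true) →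
          Σ (segment 1 M) (λ v → ⟦ d ∧ fresh v xs ⟧ * (⟦ m ⊔ v ≡ᵇ m′ ⟧ * ⟦ Φ (if m <ᵇ v then s⁺ else s) ⟧))
          ≡ ⟦ d ⟧ * (⟦ m <ᵇ m′ ⟧ * ⟦ Φ s⁺ ⟧ + (m′ ∸ length xs) * (⟦ m ≡ᵇ m′ ⟧ * ⟦ Φ s ⟧))
        Σ-appended M bds m′≤M false _    = Σ-0 (segment 1 M)
        Σ-appended M bds m′≤M true  dxs = begin
            Σ (segment 1 M) appended
          ≡⟨ cong (λ L → Σ L appended) (trans (cong (segment 1) (sym (m+[n∸m]≡n m≤M))) (segment-++ 1 m (M ∸ m))) ⟩
            Σ (segment 1 m ++ segment (suc m) (M ∸ m)) appended
          ≡⟨ Σ-++ (segment 1 m) (segment (suc m) (M ∸ m)) appended ⟩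
            Σ (segment 1 m) appended + Σ (segment (suc m) (M ∸ m)) appended
          ≡⟨ cong₂ _+_ (Σ-appended-old (dxs refl) (All.map proj₁ bds)) (Σ-appended-new M m≤M m′≤M) ⟩
            (m ∸ length xs) * (⟦ m ≡ᵇ m′ ⟧ * ⟦ Φ s ⟧) + ⟦ m <ᵇ m′ ⟧ * ⟦ Φ s⁺ ⟧
          ≡⟨ cong (_+ ⟦ m <ᵇ m′ ⟧ * ⟦ Φ s⁺ ⟧) (∸-*-⟦≡ᵇ⟧ m m′ (length xs) ⟦ Φ s ⟧) ⟩
            (m′ ∸ length xs) * (⟦ m ≡ᵇ m′ ⟧ * ⟦ Φ s ⟧) + ⟦ m <ᵇ m′ ⟧ * ⟦ Φ s⁺ ⟧
          ≡⟨ trans (+-comm ((m′ ∸ length xs) * (⟦ m ≡ᵇ m′ ⟧ * ⟦ Φ s ⟧)) _) (sym (*-identityˡ _)) ⟩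
            1 * (⟦ m <ᵇ m′ ⟧ * ⟦ Φ s⁺ ⟧ + (m′ ∸ length xs) * (⟦ m ≡ᵇ m′ ⟧ * ⟦ Φ s ⟧)) ∎
          where
          open ≡-Reasoning
          m≤M = maximum-≤ xs (All.map proj₂ bds)

      Σ-append : ∀ M → All (λ x → 1 ≤ x × x ≤ M) xs → m′ ≤ M →
        Σ (segment 1 M) (λ v → hasMax Φ m′ (xs ∷ʳ v))
        ≡ hasMaxBelow (Φ ∘ recordStep ks (suc (length xs))) m′ xs + (m′ ∸ length xs) * hasMax Φ m′ xs
      Σ-append M bds m′≤M = begin
          Σ (segment 1 M) (λ v → hasMax Φ m′ (xs ∷ʳ v))
        ≡⟨ Σ-cong-local (segment 1 M) (All.map (λ {v} (1≤v , _) → cong₂ (λ a c → ⟦ a ⟧ * c) (distinct-∷ʳ xs v)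
             (cong₂ (λ a b → ⟦ a ≡ᵇ m′ ⟧ * ⟦ Φ b ⟧) (maximum-∷ʳ xs v) (state-∷ʳ ks xs v 1≤v))) (segment-bounds 1 M)) ⟩
          Σ (segment 1 M) (λ v → ⟦ distinct xs ∧ fresh v xs ⟧ * (⟦ m ⊔ v ≡ᵇ m′ ⟧ * ⟦ Φ (if m <ᵇ v then s⁺ else s) ⟧))
        ≡⟨ Σ-appended M bds m′≤M (distinct xs) (λ d → d) ⟩
          ⟦ distinct xs ⟧ * (⟦ m <ᵇ m′ ⟧ * ⟦ Φ s⁺ ⟧ + (m′ ∸ length xs) * (⟦ m ≡ᵇ m′ ⟧ * ⟦ Φ s ⟧))
        ≡⟨ distrib ⟦ distinct xs ⟧ _ (m′ ∸ length xs) _ ⟩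
          hasMaxBelow (Φ ∘ recordStep ks (suc (length xs))) m′ xs + (m′ ∸ length xs) * hasMax Φ m′ xs ∎
        where
        open ≡-Reasoning
        distrib : ∀ d a c b → d * (a + c * b) ≡ d * a + c * (d * b)
        distrib = solve-∀

    countBelow : ∀ n M Φ → (∀ m → m ≤ M → countWithMax n M Φ m ≡ subsetsWithMax n m * permCount n Φ) →
      ∀ t → t ≤ M → Σwords n M (hasMaxBelow Φ t) ≡ subsetsWithMax (suc n) t * permCount n Φ
    countBelow n M Φ closed t t≤M = begin
        Σwords n M (hasMaxBelow Φ t)
      ≡⟨ Σ-cong (allWords n M) (λ w → by-maximum (valuesOf w)) ⟩
        Σ (allWords n M) (λ w → Σ (segment 0 t) (λ m → hasMax Φ m (valuesOf w)))
      ≡⟨ Σ-comm (allWords n M) (segment 0 t) _ ⟩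
        Σ (segment 0 t) (countWithMax n M Φ)
      ≡⟨ Σ-cong-local (segment 0 t) (All.map (λ {m} (_ , m<t) → closed m (≤-trans (<⇒≤ m<t) t≤M)) (segment-bounds 0 t)) ⟩
        Σ (segment 0 t) (λ m → subsetsWithMax n m * permCount n Φ)
      ≡⟨ *-distribʳ-Σ (segment 0 t) (permCount n Φ) (subsetsWithMax n) ⟩
        Σ (segment 0 t) (subsetsWithMax n) * permCount n Φ
      ≡⟨ cong (_* permCount n Φ) (Σ-subsetsWithMax n t) ⟩
        subsetsWithMax (suc n) t * permCount n Φ ∎
      where
      open ≡-Reasoning
      by-maximum : ∀ xs → hasMaxBelow Φ t xs ≡ Σ (segment 0 t) (λ m → hasMax Φ m xs)
      by-maximum xs = begin
        ⟦ distinct xs ⟧ * (⟦ maximum xs <ᵇ t ⟧ * ⟦ Φ (state ks xs) ⟧)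
          ≡⟨ cong (λ c → ⟦ distinct xs ⟧ * (c * ⟦ Φ (state ks xs) ⟧)) (⟦<ᵇ⟧≡Σ (maximum xs) t) ⟩
        ⟦ distinct xs ⟧ * (Σ (segment 0 t) (λ m → ⟦ maximum xs ≡ᵇ m ⟧) * ⟦ Φ (state ks xs) ⟧)
          ≡⟨ cong (⟦ distinct xs ⟧ *_) (*-distribʳ-Σ (segment 0 t) _ _) ⟨
        ⟦ distinct xs ⟧ * Σ (segment 0 t) (λ m → ⟦ maximum xs ≡ᵇ m ⟧ * ⟦ Φ (state ks xs) ⟧)
          ≡⟨ *-distribˡ-Σ (segment 0 t) ⟦ distinct xs ⟧ (λ m → ⟦ maximum xs ≡ᵇ m ⟧ * ⟦ Φ (state ks xs) ⟧) ⟨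
        Σ (segment 0 t) (λ m → hasMax Φ m xs) ∎

    countWithMax-closed : ∀ n M Φ m → m ≤ M → countWithMax n M Φ m ≡ subsetsWithMax n m * permCount n Φ
    countWithMax-closed zero    M Φ zero    _ rewrite state-[] ks = trans (+-identityʳ _) (*-identityˡ _)
    countWithMax-closed zero    M Φ (suc m) _ = refl
    countWithMax-closed (suc n) M Φ m′ m′≤M = begin
        countWithMax (suc n) M Φ m′
      ≡⟨ Σwords-suc n M (hasMax Φ m′) ⟩
        Σwords n M (λ xs → Σ (segment 1 M) (λ v → hasMax Φ m′ (xs ∷ʳ v)))
      ≡⟨ Σ-cong (allWords n M) (λ w → trans (Σ-append (valuesOf w) Φ m′ M (valuesOf-bounds w) m′≤M)
           (cong (λ l → hasMaxBelow (Φ ∘ recordStep ks (suc l)) m′ (valuesOf w) + (m′ ∸ l) * hasMax Φ m′ (valuesOf w)) (length-valuesOf w))) ⟩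
        Σwords n M (λ xs → hasMaxBelow Φ⁺ m′ xs + (m′ ∸ n) * hasMax Φ m′ xs)
      ≡⟨ trans (Σ-+ (allWords n M) _ _) (cong (Σwords n M (hasMaxBelow Φ⁺ m′) +_) (*-distribˡ-Σ (allWords n M) (m′ ∸ n) _)) ⟩
        Σwords n M (hasMaxBelow Φ⁺ m′) + (m′ ∸ n) * countWithMax n M Φ m′
      ≡⟨ cong₂ (λ a b → a + (m′ ∸ n) * b) (countBelow n M Φ⁺ (λ m → countWithMax-closed n M Φ⁺ m) m′ m′≤M)
                                          (countWithMax-closed n M Φ m′ m′≤M) ⟩
        c₁ * permCount n Φ⁺ + (m′ ∸ n) * (c₀ * permCount n Φ)
      ≡⟨ cong (c₁ * permCount n Φ⁺ +_) (*-assoc (m′ ∸ n) c₀ (permCount n Φ)) ⟨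
        c₁ * permCount n Φ⁺ + ((m′ ∸ n) * c₀) * permCount n Φ
      ≡⟨ cong (λ c → c₁ * permCount n Φ⁺ + c * permCount n Φ) (subsetsWithMax-absorb n m′) ⟩
        c₁ * permCount n Φ⁺ + (n * c₁) * permCount n Φ
      ≡⟨ collect c₁ (permCount n Φ⁺) n (permCount n Φ) ⟩
        c₁ * (n * permCount n Φ + permCount n Φ⁺) ∎
      where
      open ≡-Reasoning
      Φ⁺ = Φ ∘ recordStep ks (suc n)
      c₀ = subsetsWithMax n m′
      c₁ = subsetsWithMax (suc n) m′
      collect : ∀ b g⁺ n g → b * g⁺ + (n * b) * g ≡ b * (n * g + g⁺)
      collect = solve-∀

    -- A word of N distinct letters from {1,…,N} has maximum N: by countBelow, the words with a
    -- smaller maximum number subsetsWithMax (N + 1) N = 0.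
    no-smaller-maximum : ∀ N (f : List ℕ → Bool) → Σwords N N (λ xs → ⟦ distinct xs ⟧ * (⟦ maximum xs <ᵇ N ⟧ * ⟦ f xs ⟧)) ≡ 0
    no-smaller-maximum N f = n≤0⇒n≡0 (≤-trans
      (Σ-mono (allWords N N) (λ w → *-monoʳ-≤ ⟦ distinct (valuesOf w) ⟧ (*-monoʳ-≤ ⟦ maximum (valuesOf w) <ᵇ N ⟧ (⟦⟧≤1 (f (valuesOf w))))))
      (≤-reflexive (trans (countBelow N N (λ _ → true) (λ m → countWithMax-closed N N (λ _ → true) m) N ≤-refl)
                          (cong (_* permCount N (λ _ → true)) (subsetsWithMax-< (suc N) N (n<1+n N))))))

    selectsValue : ℕ → List ℕ → Bool
    selectsValue N xs = any (λ p → at xs p ≡ᵇ N) (selections xs ks 0)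

    ⟦distinct∧selectsValue⟧ : ∀ N xs → maximum xs ≤ N →
      ⟦ distinct xs ∧ selectsValue N xs ⟧ ≡ hasMax proj₂ N xs + ⟦ distinct xs ⟧ * (⟦ maximum xs <ᵇ N ⟧ * ⟦ selectsValue N xs ⟧)
    ⟦distinct∧selectsValue⟧ N xs max≤N with maximum xs ≟ N
    ... | yes max≡N rewrite ≡ᵇ-true max≡N | <ᵇ-false (≤-reflexive (sym max≡N)) =
      trans (⟦∧⟧ (distinct xs) _) (trans (cong (λ v → ⟦ distinct xs ⟧ * ⟦ selectsValue v xs ⟧) (sym max≡N)) (pad ⟦ distinct xs ⟧ _))
      where
      pad : ∀ d x → d * x ≡ d * (1 * x) + d * 0
      pad = solve-∀
    ... | no max≢N rewrite ≡ᵇ-false max≢N | <ᵇ-true (≤∧≢⇒< max≤N max≢N) =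
      trans (⟦∧⟧ (distinct xs) _) (pad ⟦ distinct xs ⟧ _)
      where
      pad : ∀ d x → d * x ≡ d * 0 + d * (1 * x)
      pad = solve-∀

    Σwords-selectsValue : ∀ N → Σwords N N (λ xs → ⟦ distinct xs ∧ selectsValue N xs ⟧) ≡ permCount N proj₂
    Σwords-selectsValue N = begin
        Σwords N N (λ xs → ⟦ distinct xs ∧ selectsValue N xs ⟧)
      ≡⟨ Σ-cong (allWords N N) (λ w → ⟦distinct∧selectsValue⟧ N (valuesOf w) (maximum-≤ (valuesOf w) (All.map proj₂ (valuesOf-bounds w)))) ⟩
        Σwords N N (λ xs → hasMax proj₂ N xs + below xs)
      ≡⟨ Σ-+ (allWords N N) _ (below ∘ valuesOf) ⟩
        countWithMax N N proj₂ N + Σwords N N below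
      ≡⟨ cong₂ _+_ (countWithMax-closed N N proj₂ N ≤-refl) (no-smaller-maximum N (selectsValue N)) ⟩
        subsetsWithMax N N * permCount N proj₂ + 0
      ≡⟨ trans (+-identityʳ _) (cong (_* permCount N proj₂) (subsetsWithMax-diag N)) ⟩
        1 * permCount N proj₂
      ≡⟨ *-identityˡ _ ⟩
        permCount N proj₂ ∎
      where
      open ≡-Reasoning
      below : List ℕ → ℕ
      below xs = ⟦ distinct xs ⟧ * (⟦ maximum xs <ᵇ N ⟧ * ⟦ selectsValue N xs ⟧)

  W≡permCount : ∀ {s} N (k : Vec ℕ s) → W N k ≡ permCount (toList k) N proj₂
  W≡permCount N k = begin
      W N k
    ≡⟨ length-filter (λ π → isPerm π ∧ selectsBest (toList k) π) (allWords N N) ⟩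
      Σ (allWords N N) (λ π → ⟦ isPerm π ∧ selectsBest (toList k) π ⟧)
    ≡⟨ Σ-cong (allWords N N) (λ π → cong (λ b → ⟦ b ∧ selectsBest (toList k) π ⟧) (isPerm≡distinct π)) ⟩
      Σwords N N (λ xs → ⟦ distinct xs ∧ selectsValue (toList k) N xs ⟧)
    ≡⟨ Σwords-selectsValue (toList k) N ⟩
      permCount (toList k) N proj₂ ∎
    where open ≡-Reasoning

module Thresholds where

  open import Data.Bool using (Bool; true; false; _∧_)
  open import Data.Bool.Properties using (∧-zeroʳ)
  open import Data.Fin using (toℕ; fromℕ<) renaming (zero to fzero; suc to fsuc)
  open import Data.Fin.Properties using (toℕ-fromℕ<)
  open import Data.Nat
  open import Data.Nat.Properties
  open import Data.Product using (_,_; proj₂)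
  open import Data.Sum using (inj₁; inj₂)
  open import Data.Vec using ([]; _∷_; toList)
  open import Function using (_∘_)
  open import Relation.Binary.PropositionalEquality
  open import Relation.Nullary using (yes; no)
  open NatLists
  open Selections
  open WordCounting

  fewerThan : ℕ → State → Bool
  fewerThan r (j , _) = j <ᵇ r

  SortedThresholds : ∀ {s} → Vec ℕ s → ℕ → Set
  SortedThresholds {s} k N = ∀ {a b} → a ≤ b → b ≤ suc s → kAt k N a ≤ kAt k N b

  module _ {s} (k : Vec ℕ s) (N : ℕ) where

    private
      ks = toList k
      κ  = kAt k N

    selectable≡ : ∀ j pos → selectable ks j pos ≡ (j <ᵇ s) ∧ (κ (suc j) <ᵇ pos)
    selectable≡ j pos = selectable-toList k j
      where
      selectable-toList : ∀ {m} (v : Vec ℕ m) j → selectable (toList v) j pos ≡ (j <ᵇ m) ∧ (kAt v N (suc j) <ᵇ pos)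
      selectable-toList []      j       = refl
      selectable-toList (x ∷ v) zero    = refl
      selectable-toList (x ∷ v) (suc j) = selectable-toList v j

    κ-top : κ (suc s) ≡ N
    κ-top = top k
      where
      top : ∀ {m} (v : Vec ℕ m) → kAt v N (suc m) ≡ N
      top []      = refl
      top (x ∷ v) = top v

    fewerThan-recordStep-early : ∀ r n → n < κ r → ∀ x → fewerThan r (recordStep ks (suc n) x) ≡ fewerThan r x
    fewerThan-recordStep-early r n n<κ (j , _) rewrite selectable≡ j (suc n) with κ (suc j) ≤? n
    ... | no κ≰n rewrite <ᵇ-false (≰⇒> κ≰n) | ∧-zeroʳ (j <ᵇ s) = refl
    ... | yes κ≤n with (j <ᵇ s) ∧ (κ (suc j) <ᵇ suc n)
    ...   | false = refl
    ...   | true with j <? r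
    ...     | yes j<r = trans (<ᵇ-true (≤∧≢⇒< j<r (λ { refl → <⇒≱ n<κ κ≤n }))) (sym (<ᵇ-true j<r))
    ...     | no j≮r  = trans (<ᵇ-false (≤-trans (≮⇒≥ j≮r) (n≤1+n j))) (sym (<ᵇ-false (≮⇒≥ j≮r)))

    permCount-fewerThan-early : ∀ r n → 1 ≤ r → n ≤ κ r → permCount ks n (fewerThan r) ≡ n !
    permCount-fewerThan-early r zero    1≤r _   rewrite <ᵇ-true 1≤r = refl
    permCount-fewerThan-early r (suc n) 1≤r n<κ = begin
        n * permCount ks n (fewerThan r) + permCount ks n (fewerThan r ∘ recordStep ks (suc n))
      ≡⟨ cong (n * permCount ks n (fewerThan r) +_) (permCount-cong ks n (fewerThan-recordStep-early r n n<κ)) ⟩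
        n * permCount ks n (fewerThan r) + permCount ks n (fewerThan r)
      ≡⟨ cong (λ c → n * c + c) (permCount-fewerThan-early r n 1≤r (<⇒≤ n<κ)) ⟩
        n * n ! + n !
      ≡⟨ +-comm (n * n !) (n !) ⟩
        suc n ! ∎
      where open ≡-Reasoning

    module _ (κ-mono : SortedThresholds k N) where

      fewerThan-recordStep-late : ∀ r n → r < s → κ (suc r) ≤ n →
        ∀ x → fewerThan (suc r) (recordStep ks (suc n) x) ≡ fewerThan r x
      fewerThan-recordStep-late r n r<s κ≤n (j , _) rewrite selectable≡ j (suc n) with j ≤? r
      ... | yes j≤r rewrite <ᵇ-true (≤-<-trans j≤r r<s) | <ᵇ-true (s≤s (≤-trans (κ-mono (s≤s j≤r) (m≤n⇒m≤1+n r<s)) κ≤n)) = refl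
      ... | no j≰r with (j <ᵇ s) ∧ (κ (suc j) <ᵇ suc n)
      ...   | true  = refl
      ...   | false = trans (<ᵇ-false (≰⇒> j≰r)) (sym (<ᵇ-false (<⇒≤ (≰⇒> j≰r))))

      selected-recordStep-window : ∀ r n → r ≤ s → κ r ≤ n → n < κ (suc r) →
        ∀ x → proj₂ (recordStep ks (suc n) x) ≡ fewerThan r x
      selected-recordStep-window r n r≤s κ≤n n<κ (j , _) rewrite selectable≡ j (suc n) with j <? r
      ... | yes j<r rewrite <ᵇ-true (<-≤-trans j<r r≤s) | <ᵇ-true (s≤s (≤-trans (κ-mono j<r (m≤n⇒m≤1+n r≤s)) κ≤n)) | <ᵇ-true j<r = refl
      ... | no j≮r rewrite <ᵇ-false (≮⇒≥ j≮r) with j <? s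
      ...   | no j≮s  rewrite <ᵇ-false (≮⇒≥ j≮s) = refl
      ...   | yes j<s rewrite <ᵇ-true j<s | <ᵇ-false (≤-trans n<κ (κ-mono (s≤s (≮⇒≥ j≮r)) (s≤s (<⇒≤ j<s)))) = refl

  module _ {s} (k : Vec ℕ s) (N : ℕ) (sorted : ∀ (i j : Fin s) → i Fin.≤ j → lookup k i ≤ lookup k j)
           (κₛ≤N : kAt k N s ≤ N) where

    private
      κ = kAt k N

    κ≡lookup : ∀ c (c<s : c < s) → κ (suc c) ≡ lookup k (fromℕ< c<s)
    κ≡lookup c c<s = trans (cong (λ i → κ (suc i)) (sym (toℕ-fromℕ< c<s))) (lookup≡ k (fromℕ< c<s))
      where
      lookup≡ : ∀ {m} (v : Vec ℕ m) (i : Fin m) → kAt v N (suc (toℕ i)) ≡ lookup v i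
      lookup≡ (x ∷ v) fzero    = refl
      lookup≡ (x ∷ v) (fsuc i) = lookup≡ v i

    κ-step : ∀ a → a ≤ s → κ a ≤ κ (suc a)
    κ-step zero    _   = z≤n
    κ-step (suc a) a<s with suc a <? s
    ... | yes sa<s = subst₂ _≤_ (sym (κ≡lookup a a<s)) (sym (κ≡lookup (suc a) sa<s))
                       (sorted _ _ (subst₂ _≤_ (sym (toℕ-fromℕ< a<s)) (sym (toℕ-fromℕ< sa<s)) (n≤1+n a)))
    ... | no sa≮s with refl ← ≤-antisym a<s (≮⇒≥ sa≮s) = subst (κ (suc a) ≤_) (sym (κ-top k N)) κₛ≤N

    sortedThresholds : SortedThresholds k N
    sortedThresholds {a} {zero}  z≤n _ = ≤-refl
    sortedThresholds {a} {suc b} a≤b b<ss with m≤n⇒m<n∨m≡n a≤b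
    ... | inj₁ a<sb  = ≤-trans (sortedThresholds (≤-pred a<sb) (<⇒≤ b<ss)) (κ-step b (≤-pred b<ss))
    ... | inj₂ refl  = ≤-refl

module RationalArithmetic where

  open import Data.Integer as ℤ using (ℤ; +_)
  import Data.Integer.Properties as ℤ
  open import Data.Nat as ℕ using (zero)
  import Data.Nat.Properties as ℕ
  open import Data.Rational using (1ℚ; _+_; _*_; _/_; toℚᵘ)
  open import Data.Rational.Properties
  open import Data.Rational.Unnormalised as ℚᵘ using (mkℚᵘ; *≡*)
  import Data.Rational.Unnormalised.Properties as ℚᵘ
  open import Relation.Binary.PropositionalEquality

  toℚᵘ-/ : ∀ (i : ℤ) n → toℚᵘ (i / suc n) ℚᵘ.≃ mkℚᵘ i n
  toℚᵘ-/ i n = fromℚᵘ-injective (fromℚᵘ-toℚᵘ (i / suc n))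

  fromℕ-+ : ∀ a b → fromℕ (a ℕ.+ b) ≡ fromℕ a + fromℕ b
  fromℕ-+ a b = toℚᵘ-injective (begin
    toℚᵘ (fromℕ (a ℕ.+ b))                      ≈⟨ toℚᵘ-/ (+ (a ℕ.+ b)) 0 ⟩
    mkℚᵘ (+ (a ℕ.+ b)) 0                        ≈⟨ *≡* (cong (ℤ._* + 1) (trans (ℤ.pos-+ a b)
                                                     (sym (cong₂ ℤ._+_ (ℤ.*-identityʳ (+ a)) (ℤ.*-identityʳ (+ b)))))) ⟩
    mkℚᵘ (+ a) 0 ℚᵘ.+ mkℚᵘ (+ b) 0              ≈⟨ ℚᵘ.+-cong (toℚᵘ-/ (+ a) 0) (toℚᵘ-/ (+ b) 0) ⟨
    toℚᵘ (fromℕ a) ℚᵘ.+ toℚᵘ (fromℕ b)          ≈⟨ toℚᵘ-homo-+ (fromℕ a) (fromℕ b) ⟨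
    toℚᵘ (fromℕ a + fromℕ b)                    ∎)
    where open ℚᵘ.≃-Reasoning

  fromℕ-* : ∀ a b → fromℕ (a ℕ.* b) ≡ fromℕ a * fromℕ b
  fromℕ-* a b = toℚᵘ-injective (begin
    toℚᵘ (fromℕ (a ℕ.* b))                      ≈⟨ toℚᵘ-/ (+ (a ℕ.* b)) 0 ⟩
    mkℚᵘ (+ (a ℕ.* b)) 0                        ≈⟨ *≡* (cong (ℤ._* + 1) (ℤ.pos-* a b)) ⟩
    mkℚᵘ (+ a) 0 ℚᵘ.* mkℚᵘ (+ b) 0              ≈⟨ ℚᵘ.*-cong (toℚᵘ-/ (+ a) 0) (toℚᵘ-/ (+ b) 0) ⟨
    toℚᵘ (fromℕ a) ℚᵘ.* toℚᵘ (fromℕ b)          ≈⟨ toℚᵘ-homo-* (fromℕ a) (fromℕ b) ⟨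
    toℚᵘ (fromℕ a * fromℕ b)                    ∎)
    where open ℚᵘ.≃-Reasoning

  ratio-suc : ∀ k i → ratio k (suc i) ≡ fromℕ k * invℕ (suc i)
  ratio-suc k i = toℚᵘ-injective (begin
    toℚᵘ (ratio k (suc i))                      ≈⟨ toℚᵘ-/ (+ k) i ⟩
    mkℚᵘ (+ k) i                                ≈⟨ *≡* (cong₂ ℤ._*_ (sym (ℤ.*-identityʳ (+ k))) (cong (λ j → + suc j) (ℕ.+-identityʳ i))) ⟩
    mkℚᵘ (+ k) 0 ℚᵘ.* mkℚᵘ (+ 1) i              ≈⟨ ℚᵘ.*-cong (toℚᵘ-/ (+ k) 0) (toℚᵘ-/ (+ 1) i) ⟨
    toℚᵘ (fromℕ k) ℚᵘ.* toℚᵘ (invℕ (suc i))     ≈⟨ toℚᵘ-homo-* (fromℕ k) (invℕ (suc i)) ⟨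
    toℚᵘ (fromℕ k * invℕ (suc i))               ∎)
    where open ℚᵘ.≃-Reasoning

  ratio-diag : ∀ n → ratio n n ≡ 1ℚ
  ratio-diag zero    = refl
  ratio-diag (suc n) = toℚᵘ-injective (ℚᵘ.≃-trans (toℚᵘ-/ (+ suc n) n) (*≡* (ℤ.*-comm (+ suc n) (+ 1))))

  fromℕ*invℕ : ∀ n .{{_ : ℕ.NonZero n}} → fromℕ n * invℕ n ≡ 1ℚ
  fromℕ*invℕ (suc n) = trans (sym (ratio-suc (suc n) n)) (ratio-diag (suc n))

  invℕ-* : ∀ a b → invℕ (a ℕ.* b) ≡ invℕ a * invℕ b
  invℕ-* zero    b       = sym (*-zeroˡ (invℕ b))
  invℕ-* (suc a) zero    rewrite ℕ.*-zeroʳ a = sym (*-zeroʳ (invℕ (suc a)))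
  invℕ-* (suc a) (suc b) = toℚᵘ-injective (begin
    toℚᵘ (invℕ (suc a ℕ.* suc b))               ≈⟨ toℚᵘ-/ (+ 1) (b ℕ.+ a ℕ.* suc b) ⟩
    mkℚᵘ (+ 1) a ℚᵘ.* mkℚᵘ (+ 1) b              ≈⟨ ℚᵘ.*-cong (toℚᵘ-/ (+ 1) a) (toℚᵘ-/ (+ 1) b) ⟨
    toℚᵘ (invℕ (suc a)) ℚᵘ.* toℚᵘ (invℕ (suc b)) ≈⟨ toℚᵘ-homo-* (invℕ (suc a)) (invℕ (suc b)) ⟨
    toℚᵘ (invℕ (suc a) * invℕ (suc b))          ∎)
    where open ℚᵘ.≃-Reasoning

  fromℕ*ratio : ∀ c n → c ≤ n → fromℕ n * ratio c n ≡ fromℕ c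
  fromℕ*ratio zero    zero    _ = refl
  fromℕ*ratio c       (suc n) _ = begin
    fromℕ (suc n) * ratio c (suc n)                ≡⟨ cong (fromℕ (suc n) *_) (ratio-suc c n) ⟩
    fromℕ (suc n) * (fromℕ c * invℕ (suc n))       ≡⟨ *-comm (fromℕ (suc n)) _ ⟩
    fromℕ c * invℕ (suc n) * fromℕ (suc n)         ≡⟨ *-assoc (fromℕ c) _ _ ⟩
    fromℕ c * (invℕ (suc n) * fromℕ (suc n))       ≡⟨ cong (fromℕ c *_) (trans (*-comm (invℕ (suc n)) _) (fromℕ*invℕ (suc n))) ⟩
    fromℕ c * 1ℚ                                   ≡⟨ *-identityʳ (fromℕ c) ⟩
    fromℕ c                                        ∎
    where open ≡-Reasoning

module WinningProbability where

  open import Algebra.Bundles using (CommutativeRing)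
  open import Data.Bool using (Bool)
  open import Data.List using (List; []; _∷_; _++_; _∷ʳ_)
  import Data.List.Properties
  open import Data.List.Relation.Unary.All as All using (All; []; _∷_)
  open import Data.Nat as ℕ using (zero; _∸_; _<_; z≤n; s≤s)
  open import Data.Nat.Properties as ℕ using (_!≢0)
  open import Data.Product using (_,_; proj₂)
  open import Data.Rational using (ℚ; 0ℚ; 1ℚ; _+_; _*_)
  open import Data.Rational.Properties
  open import Data.Rational.Solver using (module +-*-Solver)
  open import Data.Vec using (toList)
  open import Function using (_∘_)
  open import Relation.Binary.PropositionalEquality
  open import Relation.Nullary using (yes; no)
  open NatLists
  open Selections
  open WordCounting
  open Thresholds
  open RationalArithmetic
  open Sum (CommutativeRing.commutativeSemiring +-*-commutativeRing)
  open +-*-Solver using (solve; _:+_; _:*_; _:=_)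

  prob : List ℕ → ℕ → (State → Bool) → ℚ
  prob ks n Φ = fromℕ (permCount ks n Φ) * invℕ (n !)

  prob-suc : ∀ ks n Φ →
    prob ks (suc n) Φ ≡ (fromℕ n * prob ks n Φ + prob ks n (Φ ∘ recordStep ks (suc n))) * invℕ (suc n)
  prob-suc ks n Φ = begin
      fromℕ (n ℕ.* a ℕ.+ b) * invℕ (suc n ℕ.* n !)
    ≡⟨ cong₂ _*_ (trans (fromℕ-+ (n ℕ.* a) b) (cong (_+ fromℕ b) (fromℕ-* n a))) (invℕ-* (suc n) (n !)) ⟩
      (fromℕ n * fromℕ a + fromℕ b) * (invℕ (suc n) * invℕ (n !))
    ≡⟨ regroup (fromℕ n) (fromℕ a) (fromℕ b) (invℕ (suc n)) (invℕ (n !)) ⟩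
      (fromℕ n * (fromℕ a * invℕ (n !)) + fromℕ b * invℕ (n !)) * invℕ (suc n) ∎
    where
    open ≡-Reasoning
    a = permCount ks n Φ
    b = permCount ks n (Φ ∘ recordStep ks (suc n))
    regroup : ∀ x y z i j → (x * y + z) * (i * j) ≡ (x * (y * j) + z * j) * i
    regroup = solve 5 (λ x y z i j → (x :* y :+ z) :* (i :* j) := (x :* (y :* j) :+ z :* j) :* i) refl

  prob-cong : ∀ ks n {Φ Ψ : State → Bool} → (∀ x → Φ x ≡ Ψ x) → prob ks n Φ ≡ prob ks n Ψ
  prob-cong ks n Φ≗Ψ = cong (λ c → fromℕ c * invℕ (n !)) (permCount-cong ks n Φ≗Ψ)

  prob-none : ∀ ks n → prob ks n (fewerThan 0) ≡ 0ℚ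
  prob-none ks n = trans (cong (λ c → fromℕ c * invℕ (n !)) (trans (permCount-cong ks n (λ _ → refl)) (permCount-false ks n)))
                         (*-zeroˡ (invℕ (n !)))

  prob-all : ∀ ks n {Φ} → permCount ks n Φ ≡ n ! → prob ks n Φ ≡ 1ℚ
  prob-all ks n count≡n! = trans (cong (λ c → fromℕ c * invℕ (n !)) count≡n!) (fromℕ*invℕ (n !) {{n !≢0}})

  selectProb : List ℕ → ℕ → ℚ
  selectProb ks n = prob ks n (proj₂ ∘ recordStep ks (suc n))

  fromℕ*prob-selectsMaximum : ∀ ks n → fromℕ n * prob ks n proj₂ ≡ Σ (segment 0 n) (selectProb ks)
  fromℕ*prob-selectsMaximum ks zero    = *-zeroˡ (prob ks 0 proj₂)
  fromℕ*prob-selectsMaximum ks (suc n) = begin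
      fromℕ (suc n) * prob ks (suc n) proj₂
    ≡⟨ cong (fromℕ (suc n) *_) (prob-suc ks n proj₂) ⟩
      fromℕ (suc n) * ((fromℕ n * prob ks n proj₂ + Q n) * invℕ (suc n))
    ≡⟨ cancel (fromℕ (suc n)) (fromℕ n * prob ks n proj₂ + Q n) (invℕ (suc n)) ⟩
      (fromℕ (suc n) * invℕ (suc n)) * (fromℕ n * prob ks n proj₂ + Q n)
    ≡⟨ trans (cong (_* (fromℕ n * prob ks n proj₂ + Q n)) (fromℕ*invℕ (suc n))) (*-identityˡ _) ⟩
      fromℕ n * prob ks n proj₂ + Q n
    ≡⟨ cong₂ _+_ (fromℕ*prob-selectsMaximum ks n) (sym (+-identityʳ (Q n))) ⟩
      Σ (segment 0 n) Q + Σ (n ∷ []) Q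
    ≡⟨ trans (sym (Σ-++ (segment 0 n) (n ∷ []) Q)) (cong (λ L → Σ L Q) (sym (segment-∷ʳ 0 n))) ⟩
      Σ (segment 0 (suc n)) Q ∎
    where
    open ≡-Reasoning
    Q = selectProb ks
    cancel : ∀ a x i → a * (x * i) ≡ (a * i) * x
    cancel = solve 3 (λ a x i → a :* (x :* i) := (a :* i) :* x) refl

  nestedSummand : ℕ → List ℕ → ℕ → ℚ
  nestedSummand c []       n = ratio c n
  nestedSummand c (b ∷ ls) n = invℕ n * WG c (b ∷ ls) n

  WG≡Σ : ∀ c a ls u → WG c (a ∷ ls) u ≡ Σ (range a u) (nestedSummand c ls)
  WG≡Σ c a []       u = refl
  WG≡Σ c a (b ∷ ls) u = refl

  WG-empty : ∀ c a ls u → u ≤ a → WG c (a ∷ ls) u ≡ 0ℚ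
  WG-empty c a ls u u≤a rewrite WG≡Σ c a ls u | range-empty a u u≤a = refl

  WG-suc : ∀ c a ls n → a ≤ n → WG c (a ∷ ls) (suc n) ≡ WG c (a ∷ ls) n + nestedSummand c ls n
  WG-suc c a ls n a≤n = begin
    WG c (a ∷ ls) (suc n)                                          ≡⟨ WG≡Σ c a ls (suc n) ⟩
    Σ (range a (suc n)) (nestedSummand c ls)                       ≡⟨ cong (λ L → Σ L (nestedSummand c ls)) (range-∷ʳ a n a≤n) ⟩
    Σ (range a n ∷ʳ n) (nestedSummand c ls)                        ≡⟨ Σ-++ (range a n) (n ∷ []) (nestedSummand c ls) ⟩
    Σ (range a n) (nestedSummand c ls) + (nestedSummand c ls n + 0ℚ) ≡⟨ cong₂ _+_ (sym (WG≡Σ c a ls n)) (+-identityʳ _) ⟩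
    WG c (a ∷ ls) n + nestedSummand c ls n                         ∎
    where open ≡-Reasoning

  -- The term i = a of the outer sum vanishes, since WG c (a ∷ ls) a is an empty sum.
  Σ-invℕ*WG : ∀ c a ls u → Σ (range a u) (λ n → invℕ n * WG c (a ∷ ls) n) ≡ WG c (suc a ∷ a ∷ ls) u
  Σ-invℕ*WG c a ls u with a ℕ.<? u
  ... | yes a<u rewrite range-∷ a u a<u | WG-empty c a ls a ℕ.≤-refl =
    trans (cong (_+ Σ (range (suc a) u) (λ n → invℕ n * WG c (a ∷ ls) n)) (*-zeroʳ (invℕ a))) (+-identityˡ _)
  ... | no a≮u rewrite range-empty a u (ℕ.≮⇒≥ a≮u) | range-empty (suc a) u (ℕ.≤-trans (ℕ.≮⇒≥ a≮u) (ℕ.n≤1+n a)) = refl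

  module _ {s} (k : Vec ℕ s) (N : ℕ) where

    private
      ks = toList k
      κ  = kAt k N

    lowerThresholds : ℕ → ℕ → List ℕ
    lowerThresholds r j = map (λ m → κ (r ∸ m)) (segment 0 j)

    thresholdsBelow : ℕ → ℕ → List ℕ
    thresholdsBelow r j = map (λ m → κ (r ∸ m)) (segment 1 (j ∸ 1))

    tailSum : ℕ → ℕ → ℚ
    tailSum r n = Σ (segment 1 (r ∸ 1)) (λ j → WG (κ (r ∸ j)) (lowerThresholds r j) n)

    -- closedForm r n is the summand of B_r at i₁ = n.
    closedForm : ℕ → ℕ → ℚ
    closedForm zero    n = 0ℚ
    closedForm (suc r) n = ratio (κ (suc r)) n + invℕ n * tailSum (suc r) n

    Σ-nestedSummand : ∀ r n →
      Σ (segment 1 r) (λ j → nestedSummand (κ (suc r ∸ j)) (thresholdsBelow (suc r) j) n) ≡ closedForm r n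
    Σ-nestedSummand zero    n = refl
    Σ-nestedSummand (suc r) n = cong (ratio (κ (suc r)) n +_) (begin
        Σ (segment 2 r) summand
      ≡⟨ cong (λ L → Σ L summand) (segment-suc 1 r) ⟩
        Σ (map suc (segment 1 r)) summand
      ≡⟨ Σ-map suc (segment 1 r) summand ⟩
        Σ (segment 1 r) (summand ∘ suc)
      ≡⟨ Σ-cong-local (segment 1 r) (All.map (λ { {suc j} _ → cong (λ L → invℕ n * WG (κ (r ∸ j)) (κ (suc r) ∷ L) n) (shift j) })
                                       (segment-bounds 1 r)) ⟩
        Σ (segment 1 r) (λ j → invℕ n * WG (κ (suc r ∸ j)) (lowerThresholds (suc r) j) n)
      ≡⟨ *-distribˡ-Σ (segment 1 r) (invℕ n) _ ⟩
        invℕ n * tailSum (suc r) n ∎)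
      where
      open ≡-Reasoning
      summand : ℕ → ℚ
      summand j = nestedSummand (κ (suc (suc r) ∸ j)) (thresholdsBelow (suc (suc r)) j) n
      shift : ∀ j → map (λ m → κ (suc (suc r) ∸ m)) (segment 2 j) ≡ map (λ m → κ (suc r ∸ m)) (segment 1 j)
      shift j = trans (cong (map (λ m → κ (suc (suc r) ∸ m))) (segment-suc 1 j)) (sym (Data.List.Properties.map-∘ (segment 1 j)))

    tailSum-suc : ∀ r n → κ (suc r) ≤ n → tailSum (suc r) (suc n) ≡ tailSum (suc r) n + closedForm r n
    tailSum-suc r n κ≤n = begin
        tailSum (suc r) (suc n)
      ≡⟨ Σ-cong-local (segment 1 r) (All.map (λ { {suc j} _ → WG-suc (κ (r ∸ j)) (κ (suc r)) (thresholdsBelow (suc r) (suc j)) n κ≤n })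
                                       (segment-bounds 1 r)) ⟩
        Σ (segment 1 r) (λ j → WG (κ (suc r ∸ j)) (lowerThresholds (suc r) j) n
                               + nestedSummand (κ (suc r ∸ j)) (thresholdsBelow (suc r) j) n)
      ≡⟨ Σ-+ (segment 1 r) _ _ ⟩
        tailSum (suc r) n + Σ (segment 1 r) (λ j → nestedSummand (κ (suc r ∸ j)) (thresholdsBelow (suc r) j) n)
      ≡⟨ cong (tailSum (suc r) n +_) (Σ-nestedSummand r n) ⟩
        tailSum (suc r) n + closedForm r n ∎
      where open ≡-Reasoning

    tailSum-≤ : ∀ r n → n ≤ κ (suc r) → tailSum (suc r) n ≡ 0ℚ
    tailSum-≤ r n n≤κ = trans
      (Σ-cong-local (segment 1 r) (All.map (λ { {suc j} _ → WG-empty (κ (r ∸ j)) (κ (suc r)) (thresholdsBelow (suc r) (suc j)) n n≤κ })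
                                     (segment-bounds 1 r)))
      (Σ-0 (segment 1 r))

    closedForm-diag : ∀ r → closedForm (suc r) (κ (suc r)) ≡ 1ℚ
    closedForm-diag r = begin
        ratio (κ (suc r)) (κ (suc r)) + invℕ (κ (suc r)) * tailSum (suc r) (κ (suc r))
      ≡⟨ cong₂ _+_ (ratio-diag (κ (suc r))) (cong (invℕ (κ (suc r)) *_) (tailSum-≤ r (κ (suc r)) ℕ.≤-refl)) ⟩
        1ℚ + invℕ (κ (suc r)) * 0ℚ
      ≡⟨ cong (1ℚ +_) (*-zeroʳ (invℕ (κ (suc r)))) ⟩
        1ℚ + 0ℚ ∎
      where open ≡-Reasoning

    closedForm-suc : ∀ r n → κ (suc r) ≤ n →
      closedForm (suc r) (suc n) ≡ (fromℕ n * closedForm (suc r) n + closedForm r n) * invℕ (suc n)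
    closedForm-suc r n κ≤n = sym (begin
        (fromℕ n * (ratio κᵣ n + invℕ n * T) + closedForm r n) * invℕ (suc n)
      ≡⟨ cong (λ x → (x + closedForm r n) * invℕ (suc n))
           (trans (*-distribˡ-+ (fromℕ n) _ _) (cong₂ _+_ (fromℕ*ratio κᵣ n κ≤n) (fromℕ*invℕ*tailSum n))) ⟩
        (fromℕ κᵣ + T + closedForm r n) * invℕ (suc n)
      ≡⟨ regroup (fromℕ κᵣ) T (closedForm r n) (invℕ (suc n)) ⟩
        fromℕ κᵣ * invℕ (suc n) + invℕ (suc n) * (T + closedForm r n)
      ≡⟨ cong₂ _+_ (sym (ratio-suc κᵣ n)) (cong (invℕ (suc n) *_) (sym (tailSum-suc r n κ≤n))) ⟩
        closedForm (suc r) (suc n) ∎)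
      where
      open ≡-Reasoning
      κᵣ = κ (suc r)
      T  = tailSum (suc r) n
      fromℕ*invℕ*tailSum : ∀ m → fromℕ m * (invℕ m * tailSum (suc r) m) ≡ tailSum (suc r) m
      fromℕ*invℕ*tailSum zero    = trans (*-zeroˡ (invℕ 0 * tailSum (suc r) 0)) (sym (tailSum-≤ r 0 z≤n))
      fromℕ*invℕ*tailSum (suc m) = trans (sym (*-assoc (fromℕ (suc m)) _ _))
                                         (trans (cong (_* tailSum (suc r) (suc m)) (fromℕ*invℕ (suc m))) (*-identityˡ _))
      regroup : ∀ a t c i → (a + t + c) * i ≡ a * i + i * (t + c)
      regroup = solve 4 (λ a t c i → (a :+ t :+ c) :* i := a :* i :+ i :* (t :+ c)) refl

    Σ-closedForm≡B : ∀ r → Σ (range (κ (suc r)) (κ (suc (suc r)))) (closedForm (suc r)) ≡ B k N (suc r)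
    Σ-closedForm≡B r = begin
        Σ R (closedForm (suc r))
      ≡⟨ Σ-+ R (ratio (κ (suc r))) (λ n → invℕ n * tailSum (suc r) n) ⟩
        Σ R (ratio (κ (suc r))) + Σ R (λ n → invℕ n * tailSum (suc r) n)
      ≡⟨ cong (Σ R (ratio (κ (suc r))) +_) (begin
          Σ R (λ n → invℕ n * tailSum (suc r) n)
        ≡⟨ Σ-cong R (λ n → sym (*-distribˡ-Σ (segment 1 r) (invℕ n) (λ j → WG (κ (suc r ∸ j)) (lowerThresholds (suc r) j) n))) ⟩
          Σ R (λ n → Σ (segment 1 r) (λ j → invℕ n * WG (κ (suc r ∸ j)) (lowerThresholds (suc r) j) n))
        ≡⟨ Σ-comm R (segment 1 r) _ ⟩
          Σ (segment 1 r) (λ j → Σ R (λ n → invℕ n * WG (κ (suc r ∸ j)) (lowerThresholds (suc r) j) n))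
        ≡⟨ Σ-cong-local (segment 1 r) (All.map (λ { {suc j} _ → Σ-invℕ*WG (κ (r ∸ j)) (κ (suc r)) (thresholdsBelow (suc r) (suc j)) (κ (suc (suc r))) })
                                         (segment-bounds 1 r)) ⟩
          Σ (segment 1 r) (λ j → WG (κ (suc r ∸ j)) (suc (κ (suc r)) ∷ lowerThresholds (suc r) j) (κ (suc (suc r))))
        ≡⟨ Σ-cong (segment 1 r) (λ j → cong (λ L → WG (κ (suc r ∸ j)) (suc (κ (suc r)) ∷ map (λ m → κ (suc r ∸ m)) L) (κ (suc (suc r))))
                                            (sym (range≡segment 0 j))) ⟩
          Σ (segment 1 r) (λ j → WG (κ (suc r ∸ j)) (suc (κ (suc r)) ∷ map (λ m → κ (suc r ∸ m)) (range 0 j)) (κ (suc (suc r))))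
        ≡⟨ cong (λ L → Σ L (λ j → WG (κ (suc r ∸ j)) (suc (κ (suc r)) ∷ map (λ m → κ (suc r ∸ m)) (range 0 j)) (κ (suc (suc r)))))
                (sym (range≡segment 1 (suc r))) ⟩
          Σ (range 1 (suc r)) (λ j → WG (κ (suc r ∸ j)) (suc (κ (suc r)) ∷ map (λ m → κ (suc r ∸ m)) (range 0 j)) (κ (suc (suc r)))) ∎) ⟩
        B k N (suc r) ∎
      where
      open ≡-Reasoning
      R = range (κ (suc r)) (κ (suc (suc r)))

    module _ (κ-mono : SortedThresholds k N) where

      prob-fewerThan : ∀ r → r ≤ s → ∀ n → κ r ≤ n → prob ks n (fewerThan r) ≡ closedForm r n
      prob-fewerThan zero    _   n _   = prob-none ks n
      prob-fewerThan (suc r) r<s n κ≤n = subst P (ℕ.m+[n∸m]≡n κ≤n) (after (n ∸ κ (suc r)))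
        where
        P : ℕ → Set
        P m = prob ks m (fewerThan (suc r)) ≡ closedForm (suc r) m
        step : ∀ m → κ (suc r) ≤ m → P m → P (suc m)
        step m κ≤m ih = begin
            prob ks (suc m) (fewerThan (suc r))
          ≡⟨ prob-suc ks m (fewerThan (suc r)) ⟩
            (fromℕ m * prob ks m (fewerThan (suc r)) + prob ks m (fewerThan (suc r) ∘ recordStep ks (suc m))) * invℕ (suc m)
          ≡⟨ cong₂ (λ a b → (fromℕ m * a + b) * invℕ (suc m)) ih
               (trans (prob-cong ks m (fewerThan-recordStep-late k N κ-mono r m r<s κ≤m))
                      (prob-fewerThan r (ℕ.<⇒≤ r<s) m (ℕ.≤-trans (κ-mono (ℕ.n≤1+n r) (s≤s (ℕ.<⇒≤ r<s))) κ≤m))) ⟩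
            (fromℕ m * closedForm (suc r) m + closedForm r m) * invℕ (suc m)
          ≡⟨ closedForm-suc r m κ≤m ⟨
            closedForm (suc r) (suc m) ∎
          where open ≡-Reasoning
        after : ∀ d → P (κ (suc r) ℕ.+ d)
        after zero    = subst P (sym (ℕ.+-identityʳ (κ (suc r))))
          (trans (prob-all ks (κ (suc r)) {fewerThan (suc r)} (permCount-fewerThan-early k N (suc r) (κ (suc r)) (s≤s z≤n) ℕ.≤-refl)) (sym (closedForm-diag r)))
        after (suc d) = subst P (sym (ℕ.+-suc (κ (suc r)) d)) (step (κ (suc r) ℕ.+ d) (ℕ.m≤m+n (κ (suc r)) d) (after d))

      selectProb-window : ∀ r n → r ≤ s → κ r ≤ n → n < κ (suc r) → selectProb ks n ≡ closedForm r n
      selectProb-window r n r≤s κ≤n n<κ =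
        trans (prob-cong ks n (selected-recordStep-window k N κ-mono r n r≤s κ≤n n<κ)) (prob-fewerThan r r≤s n κ≤n)

      Σ-selectProb : ∀ m → m ≤ s → Σ (segment 0 (κ (suc m))) (selectProb ks) ≡ Σ (segment 1 m) (B k N)
      Σ-selectProb zero    _   = trans
        (Σ-cong-local (segment 0 (κ 1)) (All.map (λ {n} (_ , n<κ) → selectProb-window 0 n z≤n z≤n n<κ) (segment-bounds 0 (κ 1))))
        (Σ-0 (segment 0 (κ 1)))
      Σ-selectProb (suc m) m<s = begin
          Σ (segment 0 b) Q
        ≡⟨ cong (λ L → Σ L Q) (trans (cong (segment 0) (sym (ℕ.m+[n∸m]≡n a≤b))) (segment-++ 0 a (b ∸ a))) ⟩
          Σ (segment 0 a ++ segment a (b ∸ a)) Q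
        ≡⟨ Σ-++ (segment 0 a) (segment a (b ∸ a)) Q ⟩
          Σ (segment 0 a) Q + Σ (segment a (b ∸ a)) Q
        ≡⟨ cong₂ _+_ (Σ-selectProb m (ℕ.<⇒≤ m<s)) window ⟩
          Σ (segment 1 m) (B k N) + B k N (suc m)
        ≡⟨ trans (cong (Σ (segment 1 m) (B k N) +_) (sym (+-identityʳ _))) (sym (Σ-++ (segment 1 m) (suc m ∷ []) (B k N))) ⟩
          Σ (segment 1 m ∷ʳ suc m) (B k N)
        ≡⟨ cong (λ L → Σ L (B k N)) (segment-∷ʳ 1 m) ⟨
          Σ (segment 1 (suc m)) (B k N) ∎
        where
        open ≡-Reasoning
        Q = selectProb ks
        a = κ (suc m)
        b = κ (suc (suc m))
        a≤b = κ-mono (ℕ.n≤1+n (suc m)) (s≤s m<s)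
        window : Σ (segment a (b ∸ a)) Q ≡ B k N (suc m)
        window = begin
            Σ (segment a (b ∸ a)) Q
          ≡⟨ Σ-cong-local (segment a (b ∸ a)) (All.map (λ {n} (a≤n , n<) → selectProb-window (suc m) n m<s a≤n (subst (n <_) (ℕ.m+[n∸m]≡n a≤b) n<))
                                                 (segment-bounds a (b ∸ a))) ⟩
            Σ (segment a (b ∸ a)) (closedForm (suc m))
          ≡⟨ cong (λ L → Σ L (closedForm (suc m))) (range≡segment a b) ⟨
            Σ (range a b) (closedForm (suc m))
          ≡⟨ Σ-closedForm≡B m ⟩
            B k N (suc m) ∎

      winProbability : 1 ≤ N → fromℕ (W N k) * invℕ (N !) ≡ invℕ N * Σ (range 1 (suc s)) (B k N)
      winProbability 1≤N = begin
          fromℕ (W N k) * invℕ (N !)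
        ≡⟨ cong (λ c → fromℕ c * invℕ (N !)) (W≡permCount N k) ⟩
          prob ks N proj₂
        ≡⟨ invℕ*fromℕ N 1≤N (prob ks N proj₂) ⟨
          invℕ N * (fromℕ N * prob ks N proj₂)
        ≡⟨ cong (invℕ N *_) (fromℕ*prob-selectsMaximum ks N) ⟩
          invℕ N * Σ (segment 0 N) (selectProb ks)
        ≡⟨ cong (λ n → invℕ N * Σ (segment 0 n) (selectProb ks)) (κ-top k N) ⟨
          invℕ N * Σ (segment 0 (κ (suc s))) (selectProb ks)
        ≡⟨ cong (invℕ N *_) (Σ-selectProb s ℕ.≤-refl) ⟩
          invℕ N * Σ (segment 1 s) (B k N)
        ≡⟨ cong (λ L → invℕ N * Σ L (B k N)) (range≡segment 1 (suc s)) ⟨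
          invℕ N * Σ (range 1 (suc s)) (B k N) ∎
        where
        open ≡-Reasoning
        invℕ*fromℕ : ∀ n → 1 ≤ n → ∀ x → invℕ n * (fromℕ n * x) ≡ x
        invℕ*fromℕ (suc n) _ x = trans (sym (*-assoc (invℕ (suc n)) (fromℕ (suc n)) x))
          (trans (cong (_* x) (trans (*-comm (invℕ (suc n)) (fromℕ (suc n))) (fromℕ*invℕ (suc n)))) (*-identityˡ x))

open Thresholds using (sortedThresholds)
open WinningProbability using (winProbability)

mainTheorem13 : (s : ℕ) (k : Vec ℕ s) (N : ℕ)
    → 1 ≤ s
    → (∀ (i j : Fin s) → i Fin.≤ j → lookup k i ≤ lookup k j)
    → suc (kAt k N s) ≤ N
    → fromℕ (W N k) ℚ.* invℕ (N !)
    ≡ invℕ N ℚ.* sumℚ (map (B k N) (range 1 (suc s)))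
mainTheorem13 s k N _ sorted κₛ<N = winProbability k N (sortedThresholds k N sorted (<⇒≤ κₛ<N)) (≤-trans (s≤s z≤n) κₛ<N)
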